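{- Let $G$ be a regular tripartite tournament with tripartition $V(G)=A\cup B\cup C$, where $|A|=|B|=|C|=n$. Suppose there is a partition $V(G)=V_{11}\cup V_{12}\cup V_{21}\cup V_{22}$ satisfying $e_G(V_{1*},V_{*2})+e_G(V_{2*},V_{*1})\le \varepsilon_1 n^2$, where $V_{i*}=V_{i1}\cup V_{i2}$ and $V_{*j}=V_{1j}\cup V_{2j}$. Suppose further that $|A\,\triangle\,(V_{11}\cup V_{22})|,\ |B\,\triangle\, V_{12}|,\ |C\,\triangle\, V_{21}|\le \varepsilon_2 n$. Then $G$ is $\varepsilon_3$-close to $\mathcal{G}_\beta$ for some $\beta\in[0,1/2]$, where $\varepsilon_3\le 10\varepsilon_1+90\varepsilon_2$.
   Context: A regular tripartite tournament is a regular orientation of the complete tripartite graph with $n$ vertices in each class. For vertex sets $X,Y$, $e_G(X,Y)$ is the number of edges of $G$ directed from a vertex of $X$ to a vertex of $Y$. For $\beta\in[0,1/2]$ and disjoint sets $V_1=\overrightarrow{V_1}\cup\overleftarrow{V_1}$, $V_2$, $V_3$ with $|V_1|=|V_2|=|V_3|=n$, $|\overleftarrow{V_1}|=\beta n$, $|\overrightarrow{V_1}|=(1-\beta)n$, the family $\mathcal{G}_\beta(\overrightarrow{V_1},\overleftarrow{V_1};V_2,V_3)$ consists of the tripartite tournaments on $(V_1,V_2,V_3)$ whose edge set is $(V_3\times\overrightarrow{V_1})\cup(\overrightarrow{V_1}\times V_2)\cup(V_2\times\overleftarrow{V_1})\cup(\overleftarrow{V_1}\times V_3)$ together with a $\beta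 n$-regular bipartite graph between $V_3$ and $V_2$ oriented from $V_3$ to $V_2$ and its bipartite complement (which is $(1-\beta)n$-regular) oriented from $V_2$ to $V_3$; $\mathcal{G}_\beta$ denotes this family without specifying the sets. Two tripartite digraphs $G,H$ on the same vertex set $V$ are $\varepsilon$-close if they have the same vertex tripartition and $|E(G)\triangle E(H)|\le\varepsilon|V|^2$; $G$ is $\varepsilon$-close to a family if it is $\varepsilon$-close to some member of it.
   Formalization: The parameters $\varepsilon_1$ and $\varepsilon_2$ range over the rationals. -}

module Defs where

open import Data.Nat as ℕ using (ℕ; zero; suc; _∸_)
open import Data.Integer using (+_)
open import Data.Fin using (Fin; zero; suc; _≟_)
open import Data.Bool using (Bool; true; false; _∧_; _∨_; not; _xor_; if_then_else_)
open import Data.Product using (_×_; _,_; proj₁; proj₂; ∃-syntax)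
open import Data.Rational using (ℚ; _/_)
open import Relation.Nullary using (¬_)
open import Relation.Nullary.Decidable using (⌊_⌋)
open import Relation.Binary.PropositionalEquality using (_≡_)
open import Data.Fin.Permutation using (Permutation′; _⟨$⟩ʳ_)

⟦_⟧ : ℕ → ℚ
⟦ m ⟧ = (+ m) / 1

count : ∀ {m} → (Fin m → Bool) → ℕ
count {zero} f = 0
count {suc m} f = (if f zero then 1 else 0) ℕ.+ count (λ i → f (suc i))

sumFin : ∀ {m} → (Fin m → ℕ) → ℕ
sumFin {zero} f = 0
sumFin {suc m} f = f zero ℕ.+ sumFin (λ i → f (suc i))

-- vertices: (class index, position); class 0 = A, 1 = B, 2 = C, each of size n
Vtx : ℕ → Set
Vtx n = Fin 3 × Fin n

part : ∀ {n} → Vtx n → Fin 3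
part = proj₁

countV : ∀ {n} → (Vtx n → Bool) → ℕ
countV {n} f = sumFin {3} (λ i → count {n} (λ x → f (i , x)))

countVV : ∀ {n} → (Vtx n → Vtx n → Bool) → ℕ
countVV {n} f = sumFin {3} (λ i → sumFin {n} (λ x → countV (λ v → f (i , x) v)))

-- a digraph on Vtx n: G u v = true iff u → v is an edge
Digraph : ℕ → Set
Digraph n = Vtx n → Vtx n → Bool

IsTripartiteTournament : ∀ {n} → Digraph n → Set
IsTripartiteTournament G =
  ∀ u v → (part u ≡ part v → G u v ≡ false) × (¬ part u ≡ part v → (G u v xor G v u) ≡ true)

outdeg indeg : ∀ {n} → Digraph n → Vtx n → ℕ
outdeg G v = countV (G v)
indeg G v = countV (λ u → G u v)

IsRegularTripartiteTournament : ∀ {n} → Digraph n → Set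
IsRegularTripartiteTournament G = IsTripartiteTournament G × (∀ v → outdeg G v ≡ indeg G v)

eG : ∀ {n} → Digraph n → (Vtx n → Bool) → (Vtx n → Bool) → ℕ
eG G X Y = countVV (λ u v → X u ∧ Y v ∧ G u v)

edgeSymDiff : ∀ {n} → Digraph n → Digraph n → ℕ
edgeSymDiff G H = countVV (λ u v → G u v xor H u v)

symDiff : ∀ {n} → (Vtx n → Bool) → (Vtx n → Bool) → ℕ
symDiff X Y = countV (λ v → X v xor Y v)

_==_ : ∀ {m} → Fin m → Fin m → Bool
i == j = ⌊ i ≟ j ⌋

inA inB inC : ∀ {n} → Vtx n → Bool
inA v = part v == zero
inB v = part v == suc zero
inC v = part v == suc (suc zero)

-- The family G_β with βn = k.
-- σ assigns to each class of the (fixed) tripartition its role: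
-- role 0 = V₁, role 1 = V₂, role 2 = V₃.  L marks ←V₁ inside V₁.
-- M is the bipartite graph between V₃ and V₂ (read for u ∈ V₃, v ∈ V₂).

module Family {n : ℕ} (σ : Permutation′ 3) (L : Vtx n → Bool) (M : Vtx n → Vtx n → Bool) where
  role : Vtx n → Fin 3
  role v = σ ⟨$⟩ʳ part v

  in1 in2 in3 fw bw : Vtx n → Bool
  in1 v = role v == zero
  in2 v = role v == suc zero
  in3 v = role v == suc (suc zero)
  fw v = in1 v ∧ not (L v)
  bw v = in1 v ∧ L v

  edges : Digraph n
  edges u v =
    (in3 u ∧ fw v) ∨ (fw u ∧ in2 v) ∨ (in2 u ∧ bw v) ∨ (bw u ∧ in3 v)
    ∨ (in3 u ∧ in2 v ∧ M u v) ∨ (in2 u ∧ in3 v ∧ not (M v u))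

  Valid : ℕ → Set
  Valid k =
    (countV bw ≡ k) × (countV fw ≡ n ∸ k)
    × (∀ u → in3 u ≡ true → countV (λ v → in2 v ∧ M u v) ≡ k)
    × (∀ v → in2 v ≡ true → countV (λ u → in3 u ∧ M u v) ≡ k)

-- H ∈ G_β (same vertex tripartition as G), where βn = k
InFamily : ∀ {n} → ℕ → Digraph n → Set
InFamily {n} k H =
  ∃[ σ ] ∃[ L ] ∃[ M ] (Family.Valid {n} σ L M k × (∀ u v → H u v ≡ Family.edges σ L M u v))

Close : ∀ {n} → ℚ → Digraph n → Digraph n → Set
Close {n} ε G H = ⟦ edgeSymDiff G H ⟧ Data.Rational.≤ ε Data.Rational.* ⟦ 3 ℕ.* n ⟧ Data.Rational.* ⟦ 3 ℕ.* n ⟧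

-- G is ε-close to G_β for some β ∈ [0,1/2] (β = k/n, 2k ≤ n)
CloseToSomeGβ : ∀ {n} → ℚ → Digraph n → Set
CloseToSomeGβ {n} ε G = ∃[ k ] (2 ℕ.* k ℕ.≤ n × ∃[ H ] (InFamily k H × Close ε G H))

-- Call a vertex good if it lies in the cells its class should occupy (A in V₁₁ ∪ V₂₂, B in V₁₂, C in V₂₁)
-- and an edge bad if it goes from V_{1*} to V_{*2} or from V_{2*} to V_{*1}; there are at most 3ε₂n vertices
-- that are not good and at most ε₁n² bad edges.  Take V₁ = A with ←V₁ = A ∩ V₂₂, V₂ = C, V₃ = B (or, if
-- |A ∩ V₂₂| > n/2, exchange B and C and use A ∩ V₁₁).  Between good vertices joined by no bad edge every A–B
-- and A–C edge then already points as in G_β.  By regularity a vertex of B sends n edges into A ∪ C, so the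
-- B→C adjacency matrix has all row and column sums within the error counts of βn; deleting, inserting or
-- moving single entries lowers the total deviation by 2 at the cost of at most 3 changed entries, and ends
-- in a βn-regular matrix.  The resulting member of G_β differs from G in O(ε₁n² + ε₂n²) edges.

module Submission where

open import Defs

-- ℕ's operators are opened only inside this module, so that the theorem below can use those of ℚ.
module _ where

  open import Data.Nat using (ℕ; zero; suc; _+_; _*_; _∸_; _≤_; _<_; z≤n; s≤s; _<?_; _≤?_; ∣_-_∣)
  open import Data.Nat.Properties hiding (_≟_; suc-injective)
  open import Data.Fin using (Fin; zero; suc; _≟_)
  open import Data.Fin.Properties using (any?; suc-injective)
  open import Data.Bool using (Bool; true; false; _∨_; _∧_; not; _xor_; if_then_else_)
  open import Data.Bool.Properties using (xor-same; xor-annihilates-not; not-involutive; ∨-zeroʳ; ∨-identityʳ; ∧-assoc; ∧-distribʳ-∨; not-distribˡ-xor; not-distribʳ-xor)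
  import Data.Bool as Bool
  open import Data.Product using (_×_; _,_; proj₁; proj₂; Σ; ∃)
  open import Data.Sum using (_⊎_; inj₁; inj₂)
  open import Data.Empty using (⊥-elim)
  open import Function using (_∘_)
  open import Relation.Binary.PropositionalEquality
  open import Relation.Nullary using (¬_; yes; no; Dec)
  open import Relation.Nullary.Decidable using (_×-dec_)
  open import Data.Fin.Permutation using (Permutation′; _⟨$⟩ʳ_; _∘ₚ_) renaming (transpose to swapᵖ)
  open import Data.Nat.Solver using (module +-*-Solver)

  sumFin-cong : ∀ {m} {f g : Fin m → ℕ} → (∀ i → f i ≡ g i) → sumFin f ≡ sumFin g
  sumFin-cong {zero} h = refl
  sumFin-cong {suc m} h = cong₂ _+_ (h zero) (sumFin-cong (h ∘ suc))

  sumFin-mono-≤ : ∀ {m} {f g : Fin m → ℕ} → (∀ i → f i ≤ g i) → sumFin f ≤ sumFin g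
  sumFin-mono-≤ {zero} h = z≤n
  sumFin-mono-≤ {suc m} h = +-mono-≤ (h zero) (sumFin-mono-≤ (h ∘ suc))

  sumFin-distrib-+ : ∀ {m} (f g : Fin m → ℕ) → sumFin (λ i → f i + g i) ≡ sumFin f + sumFin g
  sumFin-distrib-+ {zero} f g = refl
  sumFin-distrib-+ {suc m} f g = begin
    f zero + g zero + sumFin (λ i → f (suc i) + g (suc i))   ≡⟨ cong (f zero + g zero +_) (sumFin-distrib-+ (f ∘ suc) (g ∘ suc)) ⟩
    f zero + g zero + (sumFin (f ∘ suc) + sumFin (g ∘ suc))  ≡⟨ +-+-comm (f zero) (g zero) _ _ ⟩
    f zero + sumFin (f ∘ suc) + (g zero + sumFin (g ∘ suc))  ∎
    where
    open ≡-Reasoning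
    +-+-comm : ∀ a b c d → (a + b) + (c + d) ≡ (a + c) + (b + d)
    +-+-comm = solve 4 (λ a b c d → (a :+ b) :+ (c :+ d) := (a :+ c) :+ (b :+ d)) refl
      where open +-*-Solver

  sumFin-const : ∀ {m} c → sumFin {m} (λ _ → c) ≡ m * c
  sumFin-const {zero} c = refl
  sumFin-const {suc m} c = cong (c +_) (sumFin-const {m} c)

  *-distribˡ-sumFin : ∀ {m} c (f : Fin m → ℕ) → sumFin (λ i → c * f i) ≡ c * sumFin f
  *-distribˡ-sumFin {zero} c f = sym (*-zeroʳ c)
  *-distribˡ-sumFin {suc m} c f =
    trans (cong (c * f zero +_) (*-distribˡ-sumFin c (f ∘ suc))) (sym (*-distribˡ-+ c (f zero) _))

  sumFin-comm : ∀ {m k} (f : Fin m → Fin k → ℕ) →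
    sumFin (λ i → sumFin (λ j → f i j)) ≡ sumFin (λ j → sumFin (λ i → f i j))
  sumFin-comm {zero} {k} f = sym (trans (sumFin-const {k} 0) (*-zeroʳ k))
  sumFin-comm {suc m} f =
    trans (cong (sumFin (f zero) +_) (sumFin-comm (f ∘ suc))) (sym (sumFin-distrib-+ (f zero) _))

  sumFin-≤-const : ∀ {m} {f : Fin m → ℕ} c → (∀ i → f i ≤ c) → sumFin f ≤ m * c
  sumFin-≤-const {m} c h = ≤-trans (sumFin-mono-≤ h) (≤-reflexive (sumFin-const {m} c))

  term≤sumFin : ∀ {m} (f : Fin m → ℕ) i → f i ≤ sumFin f
  term≤sumFin f zero = m≤m+n _ _
  term≤sumFin f (suc i) = ≤-trans (term≤sumFin (f ∘ suc) i) (m≤n+m _ (f zero))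

  χ : Bool → ℕ
  χ b = if b then 1 else 0

  count≡sumFin : ∀ {m} (f : Fin m → Bool) → count f ≡ sumFin (χ ∘ f)
  count≡sumFin {zero} f = refl
  count≡sumFin {suc m} f = cong (χ (f zero) +_) (count≡sumFin (f ∘ suc))

  count≤m : ∀ {m} (f : Fin m → Bool) → count f ≤ m
  count≤m {zero} f = z≤n
  count≤m {suc m} f with f zero
  ... | true = s≤s (count≤m (f ∘ suc))
  ... | false = m≤n⇒m≤1+n (count≤m (f ∘ suc))

  count-mono : ∀ {m} {f g : Fin m → Bool} → (∀ i → f i ≡ true → g i ≡ true) → count f ≤ count g
  count-mono {zero} h = z≤n
  count-mono {suc m} {f} {g} h with f zero in fz | g zero in gz
  ... | true | true = s≤s (count-mono (h ∘ suc))
  ... | true | false with () ← trans (sym (h zero fz)) gz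
  ... | false | true = m≤n⇒m≤1+n (count-mono (h ∘ suc))
  ... | false | false = count-mono (h ∘ suc)

  count-cong : ∀ {m} {f g : Fin m → Bool} → (∀ i → f i ≡ g i) → count f ≡ count g
  count-cong h = ≤-antisym (count-mono (λ i → trans (sym (h i)))) (count-mono (λ i → trans (h i)))

  count-none : ∀ {m} (f : Fin m → Bool) → (∀ i → f i ≡ false) → count f ≡ 0
  count-none {zero} f h = refl
  count-none {suc m} f h rewrite h zero = count-none (f ∘ suc) (h ∘ suc)

  count-all : ∀ {m} (f : Fin m → Bool) → (∀ i → f i ≡ true) → count f ≡ m
  count-all {zero} f h = refl
  count-all {suc m} f h rewrite h zero = cong suc (count-all (f ∘ suc) (h ∘ suc))

  count-∨+count-∧ : ∀ {m} (f g : Fin m → Bool) →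
    count (λ i → f i ∨ g i) + count (λ i → f i ∧ g i) ≡ count f + count g
  count-∨+count-∧ {zero} f g = refl
  count-∨+count-∧ {suc m} f g with f zero | g zero | count-∨+count-∧ (f ∘ suc) (g ∘ suc)
  ... | true | true | ih = cong suc (trans (+-suc _ _) (trans (cong suc ih) (sym (+-suc _ _))))
  ... | true | false | ih = cong suc ih
  ... | false | true | ih = trans (cong suc ih) (sym (+-suc _ _))
  ... | false | false | ih = ih

  count-∨≤ : ∀ {m} (f g : Fin m → Bool) → count (λ i → f i ∨ g i) ≤ count f + count g
  count-∨≤ f g = ≤-trans (m≤m+n _ _) (≤-reflexive (count-∨+count-∧ f g))

  count+count-not : ∀ {m} (f : Fin m → Bool) → count f + count (not ∘ f) ≡ m
  count+count-not {zero} f = refl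
  count+count-not {suc m} f with f zero
  ... | true = cong suc (count+count-not (f ∘ suc))
  ... | false = trans (+-suc _ _) (cong suc (count+count-not (f ∘ suc)))

  ∣-∣≤ : ∀ {a b c} → a ≤ b + c → b ≤ a + c → ∣ a - b ∣ ≤ c
  ∣-∣≤ {a} {b} {c} a≤b+c b≤a+c with ∣m-n∣≡[m∸n]∨[n∸m] a b
  ... | inj₁ eq = subst (_≤ c) (sym eq) (m≤n+o⇒m∸n≤o a b a≤b+c)
  ... | inj₂ eq = subst (_≤ c) (sym eq) (m≤n+o⇒m∸n≤o b a b≤a+c)

  ∣-∣≤-bound : ∀ {a b c} → a ≤ c → b ≤ c → ∣ a - b ∣ ≤ c
  ∣-∣≤-bound {a} {b} a≤c b≤c = ≤-trans (∣m-n∣≤m⊔n a b) (⊔-lub a≤c b≤c)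

  ∣-∣-balance : ∀ a a′ b b′ → a + a′ ≡ b + b′ → ∣ a - b ∣ ≡ ∣ a′ - b′ ∣
  ∣-∣-balance a a′ b b′ eq = begin
    ∣ a - b ∣               ≡⟨ ∣m+n-m+o∣≡∣n-o∣ a′ a b ⟨
    ∣ a′ + a - a′ + b ∣     ≡⟨ cong₂ ∣_-_∣ (trans (+-comm a′ a) eq) (+-comm a′ b) ⟩
    ∣ b + b′ - b + a′ ∣     ≡⟨ ∣m+n-m+o∣≡∣n-o∣ b b′ a′ ⟩
    ∣ b′ - a′ ∣             ≡⟨ ∣-∣-comm b′ a′ ⟩
    ∣ a′ - b′ ∣             ∎
    where open ≡-Reasoning

  ∣suc-∣≡suc∣-∣ : ∀ {a k} → k ≤ a → ∣ suc a - k ∣ ≡ suc ∣ a - k ∣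
  ∣suc-∣≡suc∣-∣ {a} {zero} z≤n = cong suc (sym (∣-∣-identityʳ a))
  ∣suc-∣≡suc∣-∣ {suc a} {suc k} (s≤s k≤a) = ∣suc-∣≡suc∣-∣ k≤a

  ∣-∣≡suc∣suc-∣ : ∀ {a k} → a < k → ∣ a - k ∣ ≡ suc ∣ suc a - k ∣
  ∣-∣≡suc∣suc-∣ {zero} {suc k} (s≤s z≤n) = refl
  ∣-∣≡suc∣suc-∣ {suc a} {suc k} (s≤s a<k) = ∣-∣≡suc∣suc-∣ a<k

  count-∨-split : ∀ {m} {f g h : Fin m → Bool} → (∀ i → f i ≡ true → g i ≡ true ⊎ h i ≡ true) →
    count f ≤ count g + count h
  count-∨-split {f = f} {g} {h} split = ≤-trans (count-mono ∨-true) (count-∨≤ g h)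
    where
    ∨-true : ∀ i → f i ≡ true → (g i ∨ h i) ≡ true
    ∨-true i fi with split i fi
    ... | inj₁ gi rewrite gi = refl
    ... | inj₂ hi rewrite hi = ∨-zeroʳ (g i)

  ∣count-count∣≤count-xor : ∀ {m} (f g : Fin m → Bool) → ∣ count f - count g ∣ ≤ count (λ i → f i xor g i)
  ∣count-count∣≤count-xor f g =
    ∣-∣≤ (count-∨-split (λ i → xor-or-right (f i) (g i))) (count-∨-split (λ i → xor-or-left (f i) (g i)))
    where
    xor-or-right : ∀ a b → a ≡ true → b ≡ true ⊎ (a xor b) ≡ true
    xor-or-right true true _ = inj₁ refl
    xor-or-right true false _ = inj₂ refl
    xor-or-left : ∀ a b → b ≡ true → a ≡ true ⊎ (a xor b) ≡ true
    xor-or-left true true _ = inj₁ refl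
    xor-or-left false true _ = inj₂ refl

  ≡⇒xor≢true : ∀ {a b} → a ≡ b → ¬ (a xor b) ≡ true
  ≡⇒xor≢true {a} refl differs with () ← trans (sym differs) (xor-same a)

  ==-refl : ∀ {m} (i : Fin m) → (i == i) ≡ true
  ==-refl i with i ≟ i
  ... | yes _ = refl
  ... | no i≢i = ⊥-elim (i≢i refl)

  ==-≢ : ∀ {m} {i j : Fin m} → ¬ i ≡ j → (i == j) ≡ false
  ==-≢ {i = i} {j} i≢j with i ≟ j
  ... | yes i≡j = ⊥-elim (i≢j i≡j)
  ... | no _ = refl

  δ : ∀ {m} → Fin m → Fin m → ℕ
  δ i a = χ (a == i)

  δ-diag : ∀ {m} (i : Fin m) → δ i i ≡ 1
  δ-diag i rewrite ==-refl i = refl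

  δ-off : ∀ {m} {i a : Fin m} → ¬ a ≡ i → δ i a ≡ 0
  δ-off a≢i rewrite ==-≢ a≢i = refl

  count-toggle-on : ∀ {m} {f g : Fin m → Bool} (j : Fin m) → (∀ x → ¬ x ≡ j → f x ≡ g x) →
    f j ≡ false → g j ≡ true → suc (count f) ≡ count g
  count-toggle-on {suc m} zero same fj gj rewrite fj | gj =
    cong suc (count-cong (λ x → same (suc x) (λ ())))
  count-toggle-on {suc m} {f} {g} (suc j) same fj gj =
    trans (sym (+-suc (χ (f zero)) _))
          (cong₂ _+_ (cong χ (same zero (λ ()))) (count-toggle-on j (λ x x≢j → same (suc x) (x≢j ∘ suc-injective)) fj gj))

  sumFin-δ : ∀ {m} (i : Fin m) → sumFin (δ i) ≡ 1
  sumFin-δ {m} i = begin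
    sumFin (δ i)                    ≡⟨ count≡sumFin (_== i) ⟨
    count (_== i)                   ≡⟨ count-toggle-on i (λ x x≢i → sym (==-≢ x≢i)) refl (==-refl i) ⟨
    suc (count {m} (λ _ → false))   ≡⟨ cong suc (count-none {m} _ (λ _ → refl)) ⟩
    1                               ∎
    where open ≡-Reasoning

  -- Regularising a 0/1 matrix

  Matrix : ℕ → Set
  Matrix n = Fin n → Fin n → Bool

  rowSum colSum : ∀ {n} → Matrix n → Fin n → ℕ
  rowSum M i = count (M i)
  colSum M j = count (λ i → M i j)

  IsRegular : ∀ {n} → ℕ → Matrix n → Set
  IsRegular k M = (∀ i → rowSum M i ≡ k) × (∀ j → colSum M j ≡ k)

  dev : ∀ {n} → ℕ → (Fin n → ℕ) → ℕ
  dev k r = sumFin (λ a → ∣ r a - k ∣)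

  Dev : ∀ {n} → ℕ → Matrix n → ℕ
  Dev k M = dev k (rowSum M) + dev k (colSum M)

  distance : ∀ {n} → Matrix n → Matrix n → ℕ
  distance M N = sumFin (λ i → count (λ j → M i j xor N i j))

  Closer : ℕ → ℕ → ℕ → Set
  Closer k x x′ = ∣ x - k ∣ ≡ suc ∣ x′ - k ∣

  closer-down : ∀ {k x x′} → k < x → suc x′ ≡ x → Closer k x x′
  closer-down k<x refl = ∣suc-∣≡suc∣-∣ (≤-pred k<x)

  closer-up : ∀ {k x x′} → x < k → x′ ≡ suc x → Closer k x x′
  closer-up x<k refl = ∣-∣≡suc∣suc-∣ x<k

  dev-cong : ∀ {n} k {r r′ : Fin n → ℕ} → (∀ a → r′ a ≡ r a) → dev k r′ ≡ dev k r
  dev-cong k eq = sumFin-cong (λ a → cong (λ x → ∣ x - k ∣) (eq a))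

  dev-decrease : ∀ {n} k {r r′ w : Fin n → ℕ} → (∀ a → ∣ r′ a - k ∣ + w a ≡ ∣ r a - k ∣) →
    dev k r′ + sumFin w ≡ dev k r
  dev-decrease k {w = w} pointwise = trans (sym (sumFin-distrib-+ _ w)) (sumFin-cong pointwise)

  dev-step : ∀ {n} k {r r′ : Fin n → ℕ} i → (∀ a → ¬ a ≡ i → r′ a ≡ r a) → Closer k (r i) (r′ i) →
    dev k r′ + 1 ≡ dev k r
  dev-step k {r} {r′} i same closer = trans (cong (dev k r′ +_) (sym (sumFin-δ i))) (dev-decrease k {r} {r′} pointwise)
    where
    pointwise : ∀ a → ∣ r′ a - k ∣ + δ i a ≡ ∣ r a - k ∣
    pointwise a with a ≟ i
    ... | yes refl = trans (+-comm _ 1) (sym closer)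
    ... | no a≢i rewrite same a a≢i = +-identityʳ _

  dev-step₂ : ∀ {n} k {r r′ : Fin n → ℕ} i i′ → ¬ i ≡ i′ → (∀ a → ¬ a ≡ i → ¬ a ≡ i′ → r′ a ≡ r a) →
    Closer k (r i) (r′ i) → Closer k (r i′) (r′ i′) → dev k r′ + 2 ≡ dev k r
  dev-step₂ k {r} {r′} i i′ i≢i′ same closer closer′ = begin
    dev k r′ + 2                                       ≡⟨ cong (λ s → dev k r′ + (s + 1)) (sumFin-δ i) ⟨
    dev k r′ + (sumFin (δ i) + 1)                      ≡⟨ cong (λ s → dev k r′ + (sumFin (δ i) + s)) (sumFin-δ i′) ⟨
    dev k r′ + (sumFin (δ i) + sumFin (δ i′))          ≡⟨ cong (dev k r′ +_) (sumFin-distrib-+ (δ i) (δ i′)) ⟨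
    dev k r′ + sumFin (λ a → δ i a + δ i′ a)           ≡⟨ dev-decrease k {r} {r′} pointwise ⟩
    dev k r                                            ∎
    where
    open ≡-Reasoning
    pointwise : ∀ a → ∣ r′ a - k ∣ + (δ i a + δ i′ a) ≡ ∣ r a - k ∣
    pointwise a with a ≟ i | a ≟ i′
    ... | yes refl | yes refl = ⊥-elim (i≢i′ refl)
    ... | yes refl | no _ = trans (+-comm _ 1) (sym closer)
    ... | no _ | yes refl = trans (+-comm _ 1) (sym closer′)
    ... | no a≢i | no a≢i′ rewrite same a a≢i a≢i′ = +-identityʳ _

  update : ∀ {n} → Matrix n → Fin n → Fin n → Bool → Matrix n
  update M i j b a c = if (a == i) ∧ (c == j) then b else M a c

  update-at : ∀ {n} (M : Matrix n) i j b → update M i j b i j ≡ b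
  update-at M i j b rewrite ==-refl i | ==-refl j = refl

  update-off-row : ∀ {n} (M : Matrix n) {i} j b {a} c → ¬ a ≡ i → update M i j b a c ≡ M a c
  update-off-row M j b c a≢i rewrite ==-≢ a≢i = refl

  update-off-col : ∀ {n} (M : Matrix n) i {j} b a {c} → ¬ c ≡ j → update M i j b a c ≡ M a c
  update-off-col M i b a c≢j rewrite ==-≢ c≢j with a == i
  ... | true = refl
  ... | false = refl

  rowSum-update-off : ∀ {n} (M : Matrix n) {i} j b {a} → ¬ a ≡ i → rowSum (update M i j b) a ≡ rowSum M a
  rowSum-update-off M j b a≢i = count-cong (λ c → update-off-row M j b c a≢i)

  colSum-update-off : ∀ {n} (M : Matrix n) i {j} b {c} → ¬ c ≡ j → colSum (update M i j b) c ≡ colSum M c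
  colSum-update-off M i b c≢j = count-cong (λ a → update-off-col M i b a c≢j)

  rowSum-remove : ∀ {n} (M : Matrix n) i j → M i j ≡ true → suc (rowSum (update M i j false) i) ≡ rowSum M i
  rowSum-remove M i j Mij = count-toggle-on j (λ c c≢j → update-off-col M i false i c≢j) (update-at M i j false) Mij

  rowSum-insert : ∀ {n} (M : Matrix n) i j → M i j ≡ false → rowSum (update M i j true) i ≡ suc (rowSum M i)
  rowSum-insert M i j Mij = sym (count-toggle-on j (λ c c≢j → sym (update-off-col M i true i c≢j)) Mij (update-at M i j true))

  colSum-remove : ∀ {n} (M : Matrix n) i j → M i j ≡ true → suc (colSum (update M i j false) j) ≡ colSum M j
  colSum-remove M i j Mij = count-toggle-on i (λ a a≢i → update-off-row M j false j a≢i) (update-at M i j false) Mij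

  colSum-insert : ∀ {n} (M : Matrix n) i j → M i j ≡ false → colSum (update M i j true) j ≡ suc (colSum M j)
  colSum-insert M i j Mij = sym (count-toggle-on i (λ a a≢i → sym (update-off-row M j true j a≢i)) Mij (update-at M i j true))

  distance-refl : ∀ {n} (M : Matrix n) → distance M M ≡ 0
  distance-refl {n} M = begin
    distance M M              ≡⟨ sumFin-cong (λ a → count-none _ (λ c → xor-same (M a c))) ⟩
    sumFin {n} (λ _ → 0)      ≡⟨ sumFin-const {n} 0 ⟩
    n * 0                     ≡⟨ *-zeroʳ n ⟩
    0                         ∎
    where open ≡-Reasoning

  distance-triangle : ∀ {n} (M P N : Matrix n) → distance M N ≤ distance M P + distance P N
  distance-triangle M P N = ≤-trans
    (sumFin-mono-≤ (λ a → count-∨-split (λ c → xor-split (M a c) (P a c) (N a c))))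
    (≤-reflexive (sumFin-distrib-+ (λ a → count (λ c → M a c xor P a c)) (λ a → count (λ c → P a c xor N a c))))
    where
    xor-split : ∀ x y z → (x xor z) ≡ true → (x xor y) ≡ true ⊎ (y xor z) ≡ true
    xor-split true true false _ = inj₂ refl
    xor-split true false false _ = inj₁ refl
    xor-split false true true _ = inj₁ refl
    xor-split false false true _ = inj₂ refl

  distance-update : ∀ {n} (M : Matrix n) i j b → distance M (update M i j b) ≤ 1
  distance-update M i j b = ≤-trans (sumFin-mono-≤ row≤δ) (≤-reflexive (sumFin-δ i))
    where
    unchanged : ∀ {a c} → M a c ≡ update M i j b a c → (M a c xor update M i j b a c) ≡ false
    unchanged {a} {c} eq = trans (cong (M a c xor_) (sym eq)) (xor-same (M a c))
    changed⇒col : ∀ c → (M i c xor update M i j b i c) ≡ true → (c == j) ≡ true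
    changed⇒col c ch = decide (c ≟ j)
      where
      decide : Dec (c ≡ j) → (c == j) ≡ true
      decide (yes refl) = ==-refl c
      decide (no c≢j) with () ← trans (sym ch) (unchanged (sym (update-off-col M i b i c≢j)))
    row≤δ : ∀ a → count (λ c → M a c xor update M i j b a c) ≤ δ i a
    row≤δ a = decide (a ≟ i)
      where
      decide : Dec (a ≡ i) → count (λ c → M a c xor update M i j b a c) ≤ δ i a
      decide (yes refl) rewrite δ-diag a =
        ≤-trans (count-mono changed⇒col) (≤-reflexive (trans (count≡sumFin (_== j)) (sumFin-δ j)))
      decide (no a≢i) rewrite δ-off a≢i =
        ≤-reflexive (count-none _ (λ c → unchanged (sym (update-off-row M j b c a≢i))))

  Step : ∀ {n} → ℕ → Matrix n → Set
  Step {n} k M = Σ (Matrix n) λ M′ → Dev k M′ + 2 ≤ Dev k M × distance M M′ ≤ 3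

  +-pair-step : ∀ {a b c d} → a + 1 ≡ b → c + 1 ≡ d → (a + c) + 2 ≡ b + d
  +-pair-step {a} {c = c} refl refl = regroup a c
    where
    open +-*-Solver
    regroup : ∀ a c → (a + c) + 2 ≡ (a + 1) + (c + 1)
    regroup = solve 2 (λ a c → (a :+ c) :+ con 2 := (a :+ con 1) :+ (c :+ con 1)) refl

  +-left-step : ∀ {a b c d} → a + 2 ≡ b → c ≡ d → (a + c) + 2 ≡ b + d
  +-left-step {a} {c = c} refl refl = trans (+-assoc a c 2) (trans (cong (a +_) (+-comm c 2)) (sym (+-assoc a 2 c)))

  step-remove : ∀ {n} k (M : Matrix n) i j → M i j ≡ true → k < rowSum M i → k < colSum M j → Step k M
  step-remove {n} k M i j Mij heavyRow heavyCol =
    M′ , ≤-reflexive (+-pair-step rows cols) , ≤-trans (distance-update M i j false) (s≤s z≤n)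
    where
    M′ : Matrix n
    M′ = update M i j false
    rows : dev k (rowSum M′) + 1 ≡ dev k (rowSum M)
    rows = dev-step k i (λ a a≢i → rowSum-update-off M j false a≢i) (closer-down heavyRow (rowSum-remove M i j Mij))
    cols : dev k (colSum M′) + 1 ≡ dev k (colSum M)
    cols = dev-step k j (λ c c≢j → colSum-update-off M i false c≢j) (closer-down heavyCol (colSum-remove M i j Mij))

  -- Entries (i,j′) and (i′,j) move to (i′,j′): row i and column j lose one, all other sums are kept.
  step-swap : ∀ {n} k (M : Matrix n) i i′ j j′ → M i j ≡ false → M i j′ ≡ true → M i′ j ≡ true → M i′ j′ ≡ false →
    k < rowSum M i → k < colSum M j → Step k M
  step-swap {n} k M i i′ j j′ Mij Mij′ Mi′j Mi′j′ heavyRow heavyCol =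
    M₃ , ≤-reflexive (+-pair-step rows cols) , ≤-trans (distance-triangle M M₁ M₃) (+-mono-≤ (distance-update M i j′ false) moves₂₃)
    where
    i≢i′ : ¬ i ≡ i′
    i≢i′ refl with () ← trans (sym Mij) Mi′j
    j≢j′ : ¬ j ≡ j′
    j≢j′ refl with () ← trans (sym Mij) Mij′
    M₁ M₂ M₃ : Matrix n
    M₁ = update M i j′ false
    M₂ = update M₁ i′ j false
    M₃ = update M₂ i′ j′ true
    M₁i′j : M₁ i′ j ≡ true
    M₁i′j = trans (update-off-row M j′ false j (i≢i′ ∘ sym)) Mi′j
    M₂i′j′ : M₂ i′ j′ ≡ false
    M₂i′j′ = trans (update-off-col M₁ i′ false i′ (j≢j′ ∘ sym)) (trans (update-off-row M j′ false j′ (i≢i′ ∘ sym)) Mi′j′)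
    moves₂₃ : distance M₁ M₃ ≤ 2
    moves₂₃ = ≤-trans (distance-triangle M₁ M₂ M₃) (+-mono-≤ (distance-update M₁ i′ j false) (distance-update M₂ i′ j′ true))
    rowSum-other : ∀ a → ¬ a ≡ i → Dec (a ≡ i′) → rowSum M₃ a ≡ rowSum M a
    rowSum-other a a≢i (yes refl) = begin
      rowSum M₃ a         ≡⟨ rowSum-insert M₂ a j′ M₂i′j′ ⟩
      suc (rowSum M₂ a)   ≡⟨ rowSum-remove M₁ a j M₁i′j ⟩
      rowSum M₁ a         ≡⟨ rowSum-update-off M j′ false a≢i ⟩
      rowSum M a          ∎
      where open ≡-Reasoning
    rowSum-other a a≢i (no a≢i′) =
      trans (rowSum-update-off M₂ j′ true a≢i′) (trans (rowSum-update-off M₁ j false a≢i′) (rowSum-update-off M j′ false a≢i))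
    colSum-other : ∀ c → ¬ c ≡ j → Dec (c ≡ j′) → colSum M₃ c ≡ colSum M c
    colSum-other c c≢j (yes refl) = begin
      colSum M₃ c         ≡⟨ colSum-insert M₂ i′ c M₂i′j′ ⟩
      suc (colSum M₂ c)   ≡⟨ cong suc (colSum-update-off M₁ i′ false c≢j) ⟩
      suc (colSum M₁ c)   ≡⟨ colSum-remove M i c Mij′ ⟩
      colSum M c          ∎
      where open ≡-Reasoning
    colSum-other c c≢j (no c≢j′) =
      trans (colSum-update-off M₂ i′ true c≢j′) (trans (colSum-update-off M₁ i′ false c≢j) (colSum-update-off M i false c≢j′))
    rows : dev k (rowSum M₃) + 1 ≡ dev k (rowSum M)
    rows = dev-step k i (λ a a≢i → rowSum-other a a≢i (a ≟ i′)) (closer-down heavyRow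
      (trans (cong suc (trans (rowSum-update-off M₂ j′ true i≢i′) (rowSum-update-off M₁ j false i≢i′))) (rowSum-remove M i j′ Mij′)))
    cols : dev k (colSum M₃) + 1 ≡ dev k (colSum M)
    cols = dev-step k j (λ c c≢j → colSum-other c c≢j (c ≟ j′)) (closer-down heavyCol
      (trans (cong suc (colSum-update-off M₂ i′ true j≢j′)) (trans (colSum-remove M₁ i′ j M₁i′j) (colSum-update-off M i false j≢j′))))

  step-shift : ∀ {n} k (M : Matrix n) i i′ j → M i j ≡ true → M i′ j ≡ false →
    k < rowSum M i → rowSum M i′ < k → Step k M
  step-shift {n} k M i i′ j Mij Mi′j heavy light =
    M₂ , ≤-reflexive (+-left-step rows (dev-cong k cols)) ,
    ≤-trans (distance-triangle M M₁ M₂) (+-mono-≤ (distance-update M i j false) (m≤n⇒m≤1+n (distance-update M₁ i′ j true)))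
    where
    i≢i′ : ¬ i ≡ i′
    i≢i′ refl with () ← trans (sym Mij) Mi′j
    M₁ M₂ : Matrix n
    M₁ = update M i j false
    M₂ = update M₁ i′ j true
    M₁i′j : M₁ i′ j ≡ false
    M₁i′j = trans (update-off-row M j false j (i≢i′ ∘ sym)) Mi′j
    rows : dev k (rowSum M₂) + 2 ≡ dev k (rowSum M)
    rows = dev-step₂ k i i′ i≢i′
      (λ a a≢i a≢i′ → trans (rowSum-update-off M₁ j true a≢i′) (rowSum-update-off M j false a≢i))
      (closer-down heavy (trans (cong suc (rowSum-update-off M₁ j true i≢i′)) (rowSum-remove M i j Mij)))
      (closer-up light (trans (rowSum-insert M₁ i′ j M₁i′j) (cong suc (rowSum-update-off M j false (i≢i′ ∘ sym)))))
    cols : ∀ c → colSum M₂ c ≡ colSum M c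
    cols c = decide (c ≟ j)
      where
      decide : Dec (c ≡ j) → colSum M₂ c ≡ colSum M c
      decide (yes refl) = trans (colSum-insert M₁ i′ c M₁i′j) (colSum-remove M i c Mij)
      decide (no c≢j) = trans (colSum-update-off M₁ i′ true c≢j) (colSum-update-off M i false c≢j)

  count<count⇒∃ : ∀ {m} {f g : Fin m → Bool} → count g < count f → ∃ λ j → f j ≡ true × g j ≡ false
  count<count⇒∃ {f = f} {g} g<f with any? (λ j → (f j Bool.≟ true) ×-dec (g j Bool.≟ false))
  ... | yes found = found
  ... | no none = ⊥-elim (<⇒≱ g<f (count-mono f⇒g))
    where
    f⇒g : ∀ j → f j ≡ true → g j ≡ true
    f⇒g j fj with g j in gj
    ... | true = refl
    ... | false = ⊥-elim (none (j , fj , gj))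

  0<count⇒∃ : ∀ {m} {f : Fin m → Bool} → 0 < count f → ∃ λ j → f j ≡ true
  0<count⇒∃ {m} {f} 0<f =
    let j , fj , _ = count<count⇒∃ {g = λ _ → false} (subst (_< count f) (sym (count-none {m} _ (λ _ → refl))) 0<f)
    in j , fj

  sumFin-rowSum≡sumFin-colSum : ∀ {n} (M : Matrix n) → sumFin (rowSum M) ≡ sumFin (colSum M)
  sumFin-rowSum≡sumFin-colSum M = begin
    sumFin (rowSum M)                              ≡⟨ sumFin-cong (λ a → count≡sumFin (M a)) ⟩
    sumFin (λ a → sumFin (λ c → χ (M a c)))        ≡⟨ sumFin-comm (λ a c → χ (M a c)) ⟩
    sumFin (λ c → sumFin (λ a → χ (M a c)))        ≡⟨ sumFin-cong (λ c → count≡sumFin (λ a → M a c)) ⟨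
    sumFin (colSum M)                              ∎
    where open ≡-Reasoning

  -- Double counting: the row sums cannot exceed k on average while no column sum does.
  light-columns⇒¬heavy-row : ∀ {n} k (M : Matrix n) → (∀ j → colSum M j ≤ k) → (∀ a → k ≤ rowSum M a) →
    ∀ i → ¬ k < rowSum M i
  light-columns⇒¬heavy-row {n} k M light notLight i heavy = <-irrefl refl (begin-strict
    n * k                                     ≡⟨ +-identityʳ (n * k) ⟨
    n * k + 0                                 <⟨ +-monoʳ-< (n * k) (≤-reflexive (sym (sumFin-δ i))) ⟩
    n * k + sumFin (δ i)                      ≡⟨ cong (_+ sumFin (δ i)) (sumFin-const {n} k) ⟨
    sumFin {n} (λ _ → k) + sumFin (δ i)       ≡⟨ sumFin-distrib-+ (λ _ → k) (δ i) ⟨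
    sumFin (λ a → k + δ i a)                  ≤⟨ sumFin-mono-≤ k+δ≤rowSum ⟩
    sumFin (rowSum M)                         ≡⟨ sumFin-rowSum≡sumFin-colSum M ⟩
    sumFin (colSum M)                         ≤⟨ sumFin-≤-const k light ⟩
    n * k                                     ∎)
    where
    open ≤-Reasoning
    k+δ≤rowSum : ∀ a → k + δ i a ≤ rowSum M a
    k+δ≤rowSum a with a ≟ i
    ... | yes refl = ≤-trans (≤-reflexive (+-comm k 1)) heavy
    ... | no _ = ≤-trans (≤-reflexive (+-identityʳ k)) (notLight a)

  heavy-row-column-step : ∀ {n} k (M : Matrix n) i j → k < rowSum M i → k < colSum M j → Step k M
  heavy-row-column-step {n} k M i j heavyRow heavyCol with M i j in Mij
  ... | true = step-remove k M i j Mij heavyRow heavyCol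
  ... | false with any? (λ i′ → any? (λ j′ → (M i′ j Bool.≟ true) ×-dec ((M i j′ Bool.≟ true) ×-dec (M i′ j′ Bool.≟ false))))
  ...   | yes (i′ , j′ , Mi′j , Mij′ , Mi′j′) = step-swap k M i i′ j j′ Mij Mij′ Mi′j Mi′j′ heavyRow heavyCol
  ...   | no noSwap = step-remove k M i j′ Mij′ heavyRow (<-≤-trans heavyCol colj≤colj′)
    where
    -- Without a swap, the column of any entry of row i contains column j.
    entry : ∃ λ j′ → M i j′ ≡ true
    entry = 0<count⇒∃ (≤-trans (s≤s z≤n) heavyRow)
    j′ : Fin n
    j′ = proj₁ entry
    Mij′ : M i j′ ≡ true
    Mij′ = proj₂ entry
    colj≤colj′ : colSum M j ≤ colSum M j′
    colj≤colj′ = count-mono covered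
      where
      covered : ∀ a → M a j ≡ true → M a j′ ≡ true
      covered a Maj with M a j′ in Maj′
      ... | true = refl
      ... | false = ⊥-elim (noSwap (a , j′ , Maj , Mij′ , Maj′))

  step-heavy-row : ∀ {n} k (M : Matrix n) i → k < rowSum M i → Step k M
  step-heavy-row k M i heavy with any? (λ j → k <? colSum M j)
  ... | yes (j , heavyCol) = heavy-row-column-step k M i j heavy heavyCol
  ... | no noHeavyCol with any? (λ i′ → rowSum M i′ <? k)
  ...   | yes (i′ , light) =
    let j , Mij , Mi′j = count<count⇒∃ (<-trans light heavy) in step-shift k M i i′ j Mij Mi′j heavy light
  ...   | no noLightRow = ⊥-elim (light-columns⇒¬heavy-row k M
    (λ j → ≮⇒≥ (λ h → noHeavyCol (j , h))) (λ a → ≮⇒≥ (λ h → noLightRow (a , h))) i heavy)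

  complement : ∀ {n} → Matrix n → Matrix n
  complement M a c = not (M a c)

  transpose : ∀ {n} → Matrix n → Matrix n
  transpose M a c = M c a

  Dev-complement : ∀ {n k k′} → k + k′ ≡ n → (M : Matrix n) → Dev k (complement M) ≡ Dev k′ M
  Dev-complement {n} {k} {k′} k+k′≡n M = cong₂ _+_
    (sumFin-cong (λ a → ∣-∣-balance _ (rowSum M a) k k′ (trans (+-comm _ (rowSum M a)) (trans (count+count-not (M a)) (sym k+k′≡n)))))
    (sumFin-cong (λ c → ∣-∣-balance _ (colSum M c) k k′ (trans (+-comm _ (colSum M c)) (trans (count+count-not (λ a → M a c)) (sym k+k′≡n)))))

  distance-complementʳ : ∀ {n} (M N : Matrix n) → distance M (complement N) ≡ distance (complement M) N
  distance-complementʳ M N =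
    sumFin-cong (λ a → count-cong (λ c → trans (sym (not-distribʳ-xor (M a c) (N a c))) (not-distribˡ-xor (M a c) (N a c))))

  Dev-transpose : ∀ {n} k (M : Matrix n) → Dev k (transpose M) ≡ Dev k M
  Dev-transpose k M = +-comm (dev k (colSum M)) (dev k (rowSum M))

  distance-transpose : ∀ {n} (M N : Matrix n) → distance (transpose M) N ≡ distance M (transpose N)
  distance-transpose M N = begin
    distance (transpose M) N                             ≡⟨ sumFin-cong (λ a → count≡sumFin (λ c → M c a xor N a c)) ⟩
    sumFin (λ a → sumFin (λ c → χ (M c a xor N a c)))    ≡⟨ sumFin-comm (λ a c → χ (M c a xor N a c)) ⟩
    sumFin (λ c → sumFin (λ a → χ (M c a xor N a c)))    ≡⟨ sumFin-cong (λ c → count≡sumFin (λ a → M c a xor N a c)) ⟨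
    distance M (transpose N)                             ∎
    where open ≡-Reasoning

  step-light-row : ∀ {n} k → k ≤ n → (M : Matrix n) (i : Fin n) → rowSum M i < k → Step k M
  step-light-row {n} k k≤n M i light = complement M′ , dev-drop , moved
    where
    k+[n∸k]≡n : k + (n ∸ k) ≡ n
    k+[n∸k]≡n = m+[n∸m]≡n k≤n
    heavy : n ∸ k < rowSum (complement M) i
    heavy = <-≤-trans (∸-monoʳ-< light k≤n) (≤-reflexive (sym (m+n∸n≡m′)))
      where
      m+n∸n≡m′ : rowSum (complement M) i ≡ n ∸ rowSum M i
      m+n∸n≡m′ = trans (sym (m+n∸n≡m _ (rowSum M i))) (cong (_∸ rowSum M i) (trans (+-comm _ (rowSum M i)) (count+count-not (M i))))
    step : Step (n ∸ k) (complement M)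
    step = step-heavy-row (n ∸ k) (complement M) i heavy
    M′ : Matrix n
    M′ = proj₁ step
    dev-drop : Dev k (complement M′) + 2 ≤ Dev k M
    dev-drop = begin
      Dev k (complement M′) + 2          ≡⟨ cong (_+ 2) (Dev-complement k+[n∸k]≡n M′) ⟩
      Dev (n ∸ k) M′ + 2                 ≤⟨ proj₁ (proj₂ step) ⟩
      Dev (n ∸ k) (complement M)         ≡⟨ Dev-complement (trans (+-comm (n ∸ k) k) k+[n∸k]≡n) M ⟩
      Dev k M                            ∎
      where open ≤-Reasoning
    moved : distance M (complement M′) ≤ 3
    moved = ≤-trans (≤-reflexive (distance-complementʳ M M′)) (proj₂ (proj₂ step))

  step-transpose : ∀ {n} k (M : Matrix n) → Step k (transpose M) → Step k M
  step-transpose k M (M′ , dev-drop , moved) =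
    transpose M′ ,
    ≤-trans (≤-reflexive (cong (_+ 2) (Dev-transpose k M′))) (≤-trans dev-drop (≤-reflexive (Dev-transpose k M))) ,
    ≤-trans (≤-reflexive (sym (distance-transpose M M′))) moved

  regular-or-step : ∀ {n} k → k ≤ n → (M : Matrix n) → IsRegular k M ⊎ Step k M
  regular-or-step k k≤n M
    with any? (λ i → k <? rowSum M i) | any? (λ i → rowSum M i <? k) | any? (λ j → k <? colSum M j) | any? (λ j → colSum M j <? k)
  ... | yes (i , h) | _ | _ | _ = inj₂ (step-heavy-row k M i h)
  ... | no _ | yes (i , h) | _ | _ = inj₂ (step-light-row k k≤n M i h)
  ... | no _ | no _ | yes (j , h) | _ = inj₂ (step-transpose k M (step-heavy-row k (transpose M) j h))
  ... | no _ | no _ | no _ | yes (j , h) = inj₂ (step-transpose k M (step-light-row k k≤n (transpose M) j h))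
  ... | no noHeavyRow | no noLightRow | no noHeavyCol | no noLightCol =
    inj₁ ( (λ i → ≤-antisym (≮⇒≥ (λ h → noHeavyRow (i , h))) (≮⇒≥ (λ h → noLightRow (i , h))))
         , (λ j → ≤-antisym (≮⇒≥ (λ h → noHeavyCol (j , h))) (≮⇒≥ (λ h → noLightCol (j , h)))))

  -- Each step lowers Dev by 2 and moves at most 3 ≤ 2·2 entries.
  regularise : ∀ {n} k → k ≤ n → (M : Matrix n) → Σ (Matrix n) λ N → IsRegular k N × distance M N ≤ 2 * Dev k M
  regularise {n} k k≤n M = iterate (Dev k M) M ≤-refl
    where
    iterate : ∀ fuel (M : Matrix n) → Dev k M ≤ fuel → Σ (Matrix n) λ N → IsRegular k N × distance M N ≤ 2 * Dev k M
    iterate fuel M bound with regular-or-step k k≤n M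
    ... | inj₁ regular = M , regular , ≤-trans (≤-reflexive (distance-refl M)) z≤n
    iterate zero M bound | inj₂ (M′ , dev-drop , moved) with () ← ≤-trans (m≤n+m 2 (Dev k M′)) (≤-trans dev-drop bound)
    iterate (suc fuel) M bound | inj₂ (M′ , dev-drop , moved) =
      let N , regular , distance≤ = iterate fuel M′ bound′
      in N , regular , ≤-trans (distance-triangle M M′ N) (≤-trans (+-mono-≤ moved distance≤) accounting)
      where
      bound′ : Dev k M′ ≤ fuel
      bound′ = ≤-pred (≤-trans (≤-trans (≤-reflexive (+-comm 1 (Dev k M′))) (+-monoʳ-≤ (Dev k M′) (s≤s z≤n))) (≤-trans dev-drop bound))
      accounting : 3 + 2 * Dev k M′ ≤ 2 * Dev k M
      accounting = ≤-trans (n≤1+n _) (≤-trans (≤-reflexive (double (Dev k M′))) (*-monoʳ-≤ 2 dev-drop))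
        where
        open +-*-Solver
        double : ∀ x → 4 + 2 * x ≡ 2 * (x + 2)
        double = solve 1 (λ x → con 4 :+ con 2 :* x := con 2 :* (x :+ con 2)) refl

  sumV : ∀ {n} → (Vtx n → ℕ) → ℕ
  sumV {n} f = sumFin {3} (λ c → sumFin {n} (λ x → f (c , x)))

  sumV-cong : ∀ {n} {f g : Vtx n → ℕ} → (∀ v → f v ≡ g v) → sumV f ≡ sumV g
  sumV-cong eq = sumFin-cong (λ c → sumFin-cong (λ x → eq (c , x)))

  *-distribˡ-sumV : ∀ {n} a (f : Vtx n → ℕ) → sumV (λ v → a * f v) ≡ a * sumV f
  *-distribˡ-sumV {n} a f =
    trans (sumFin-cong (λ c → *-distribˡ-sumFin a (λ x → f (c , x)))) (*-distribˡ-sumFin a (λ c → sumFin {n} (λ x → f (c , x))))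

  sumV-comm : ∀ {n} (f : Vtx n → Vtx n → ℕ) → sumV (λ u → sumV (λ v → f u v)) ≡ sumV (λ v → sumV (λ u → f u v))
  sumV-comm {n} f = begin
    sumFin (λ c → sumFin (λ x → sumFin (λ c′ → sumFin (λ y → f (c , x) (c′ , y)))))
      ≡⟨ sumFin-cong (λ c → sumFin-comm (λ x c′ → sumFin {n} (λ y → f (c , x) (c′ , y)))) ⟩
    sumFin (λ c → sumFin (λ c′ → sumFin (λ x → sumFin (λ y → f (c , x) (c′ , y)))))
      ≡⟨ sumFin-comm (λ c c′ → sumFin {n} (λ x → sumFin {n} (λ y → f (c , x) (c′ , y)))) ⟩
    sumFin (λ c′ → sumFin (λ c → sumFin (λ x → sumFin (λ y → f (c , x) (c′ , y)))))
      ≡⟨ sumFin-cong (λ c′ → sumFin-cong (λ c → sumFin-comm (λ x y → f (c , x) (c′ , y)))) ⟩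
    sumFin (λ c′ → sumFin (λ c → sumFin (λ y → sumFin (λ x → f (c , x) (c′ , y)))))
      ≡⟨ sumFin-cong (λ c′ → sumFin-comm (λ c y → sumFin {n} (λ x → f (c , x) (c′ , y)))) ⟩
    sumFin (λ c′ → sumFin (λ y → sumFin (λ c → sumFin (λ x → f (c , x) (c′ , y)))))
      ∎
    where open ≡-Reasoning

  countV≡sumV : ∀ {n} (f : Vtx n → Bool) → countV f ≡ sumV (χ ∘ f)
  countV≡sumV f = sumFin-cong (λ c → count≡sumFin (λ x → f (c , x)))

  countVV≡sumV : ∀ {n} (f : Vtx n → Vtx n → Bool) → countVV f ≡ sumV (λ u → sumV (λ v → χ (f u v)))
  countVV≡sumV f = sumFin-cong (λ c → sumFin-cong (λ x → countV≡sumV (f (c , x))))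

  countV-cong : ∀ {n} {f g : Vtx n → Bool} → (∀ v → f v ≡ g v) → countV f ≡ countV g
  countV-cong eq = sumFin-cong (λ c → count-cong (λ x → eq (c , x)))

  countVV-cong : ∀ {n} {f g : Vtx n → Vtx n → Bool} → (∀ u v → f u v ≡ g u v) → countVV f ≡ countVV g
  countVV-cong eq = sumFin-cong (λ c → sumFin-cong (λ x → countV-cong (eq (c , x))))

  countVV-flip : ∀ {n} (f : Vtx n → Vtx n → Bool) → countVV (λ u v → f v u) ≡ countVV f
  countVV-flip f = trans (countVV≡sumV (λ u v → f v u)) (trans (sumV-comm (λ u v → χ (f v u))) (sym (countVV≡sumV f)))

  countV-∨-split : ∀ {n} {f : Vtx n → Bool} (g h : Vtx n → Bool) → (∀ v → f v ≡ true → g v ≡ true ⊎ h v ≡ true) →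
    countV f ≤ countV g + countV h
  countV-∨-split {n} g h split = ≤-trans
    (sumFin-mono-≤ (λ c → count-∨-split (λ x → split (c , x))))
    (≤-reflexive (sumFin-distrib-+ (λ c → count {n} (λ x → g (c , x))) (λ c → count {n} (λ x → h (c , x)))))

  countVV-mono : ∀ {n} {f g : Vtx n → Vtx n → Bool} → (∀ u v → f u v ≡ true → g u v ≡ true) → countVV f ≤ countVV g
  countVV-mono f⇒g = sumFin-mono-≤ (λ c → sumFin-mono-≤ (λ x → sumFin-mono-≤ (λ c′ → count-mono (λ y → f⇒g (c , x) (c′ , y)))))

  countVV-∨ : ∀ {n} (f g : Vtx n → Vtx n → Bool) → countVV (λ u v → f u v ∨ g u v) ≤ countVV f + countVV g
  countVV-∨ {n} f g = ≤-trans
    (sumFin-mono-≤ (λ c → sumFin-mono-≤ (λ x → countV-∨-split (f (c , x)) (g (c , x)) (λ v → ∨-split (f (c , x) v)))))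
    (≤-trans (≤-reflexive (sumFin-cong (λ c → sumFin-distrib-+ (λ x → countV (f (c , x))) (λ x → countV (g (c , x))))))
      (≤-reflexive (sumFin-distrib-+ (λ c → sumFin {n} (λ x → countV (f (c , x)))) (λ c → sumFin {n} (λ x → countV (g (c , x)))))))
    where
    ∨-split : ∀ a {b} → (a ∨ b) ≡ true → a ≡ true ⊎ b ≡ true
    ∨-split true _ = inj₁ refl
    ∨-split false b = inj₂ b

  countVV-∨-≤ : ∀ {n} (f g : Vtx n → Vtx n → Bool) {a b} → countVV f ≤ a → countVV g ≤ b →
    countVV (λ u v → f u v ∨ g u v) ≤ a + b
  countVV-∨-≤ f g f≤a g≤b = ≤-trans (countVV-∨ f g) (+-mono-≤ f≤a g≤b)

  count≤countV : ∀ {n} (f : Vtx n → Bool) c → count (λ x → f (c , x)) ≤ countV f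
  count≤countV f = term≤sumFin (λ c → count (λ x → f (c , x)))

  sumFin-count≤countVV : ∀ {n} (R : Vtx n → Vtx n → Bool) c c′ → sumFin (λ x → count (λ y → R (c , x) (c′ , y))) ≤ countVV R
  sumFin-count≤countVV R c c′ =
    ≤-trans (sumFin-mono-≤ (λ x → count≤countV (R (c , x)) c′)) (term≤sumFin (λ c → sumFin (λ x → countV (R (c , x)))) c)

  countV-all : ∀ {n} → countV {n} (λ _ → true) ≡ 3 * n
  countV-all {n} rewrite count-all {n} (λ _ → true) (λ _ → refl) = refl

  countVV-source : ∀ {n} (g : Vtx n → Bool) → countVV (λ u v → g u) ≡ (3 * n) * countV g
  countVV-source {n} g = begin
    countVV (λ u v → g u)                  ≡⟨ countVV≡sumV (λ u v → g u) ⟩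
    sumV (λ u → sumV {n} (λ v → χ (g u)))  ≡⟨ sumV-cong (λ u → constant (g u)) ⟩
    sumV (λ u → 3 * n * χ (g u))           ≡⟨ *-distribˡ-sumV (3 * n) (χ ∘ g) ⟩
    3 * n * sumV (χ ∘ g)                   ≡⟨ cong (3 * n *_) (countV≡sumV g) ⟨
    3 * n * countV g                       ∎
    where
    open ≡-Reasoning
    constant : ∀ b → sumV {n} (λ _ → χ b) ≡ 3 * n * χ b
    constant true = trans (sym (countV≡sumV {n} (λ _ → true))) (trans (countV-all {n}) (sym (*-identityʳ (3 * n))))
    constant false = trans (sym (countV≡sumV {n} (λ _ → false)))
      (trans (sumFin-cong {3} (λ c → count-none {n} _ (λ _ → refl))) (sym (*-zeroʳ (3 * n))))

  countVV-target : ∀ {n} (g : Vtx n → Bool) → countVV (λ u v → g v) ≡ (3 * n) * countV g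
  countVV-target g = trans (countVV-flip (λ u v → g u)) (countVV-source g)

  -- Regular tripartite tournaments

  pattern 𝐴 = zero
  pattern 𝐵 = suc zero
  pattern 𝐶 = suc (suc zero)

  module RegularTournament {n : ℕ} (G : Digraph n) (regular : IsRegularTripartiteTournament G) where

    no-edge-in-class : ∀ c x y → G (c , x) (c , y) ≡ false
    no-edge-in-class c x y = proj₁ (proj₁ regular (c , x) (c , y)) refl

    one-way : ∀ c c′ x y → ¬ c ≡ c′ → G (c , x) (c′ , y) ≡ not (G (c′ , y) (c , x))
    one-way c c′ x y c≢c′ = xor≡true (proj₂ (proj₁ regular (c , x) (c′ , y)) c≢c′)
      where
      xor≡true : ∀ {a b} → (a xor b) ≡ true → a ≡ not b
      xor≡true {true} {false} _ = refl
      xor≡true {false} {true} _ = refl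

    out+in-other-class : ∀ c c₀ x → ¬ c ≡ c₀ →
      count (λ y → G (c₀ , x) (c , y)) + count (λ y → G (c , y) (c₀ , x)) ≡ n
    out+in-other-class c c₀ x c≢c₀ = begin
      count (λ y → G (c₀ , x) (c , y)) + count (λ y → G (c , y) (c₀ , x))        ≡⟨ count-∨+count-∧ (λ y → G (c₀ , x) (c , y)) (λ y → G (c , y) (c₀ , x)) ⟨
      count (λ y → G (c₀ , x) (c , y) ∨ G (c , y) (c₀ , x))
        + count (λ y → G (c₀ , x) (c , y) ∧ G (c , y) (c₀ , x))                  ≡⟨ cong₂ _+_ (count-all _ either) (count-none _ notBoth) ⟩
      n + 0                                                                      ≡⟨ +-identityʳ n ⟩
      n                                                                          ∎
      where
      open ≡-Reasoning
      flipped : ∀ y → G (c₀ , x) (c , y) ≡ not (G (c , y) (c₀ , x))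
      flipped y = one-way c₀ c x y (c≢c₀ ∘ sym)
      either : ∀ y → (G (c₀ , x) (c , y) ∨ G (c , y) (c₀ , x)) ≡ true
      either y rewrite flipped y with G (c , y) (c₀ , x)
      ... | true = refl
      ... | false = refl
      notBoth : ∀ y → (G (c₀ , x) (c , y) ∧ G (c , y) (c₀ , x)) ≡ false
      notBoth y rewrite flipped y with G (c , y) (c₀ , x)
      ... | true = refl
      ... | false = refl

    out+in-own-class : ∀ c x → count (λ y → G (c , x) (c , y)) + count (λ y → G (c , y) (c , x)) ≡ 0
    out+in-own-class c x = cong₂ _+_ (count-none _ (no-edge-in-class c x)) (count-none _ (λ y → no-edge-in-class c y x))

    outdeg+indeg : ∀ v → outdeg G v + indeg G v ≡ n + n
    outdeg+indeg (c₀ , x) = trans (sym (sumFin-distrib-+ (λ c → count (λ y → G (c₀ , x) (c , y))) (λ c → count (λ y → G (c , y) (c₀ , x)))))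
                                  (by-class c₀)
      where
      by-class : ∀ c₀ → sumFin {3} (λ c → count (λ y → G (c₀ , x) (c , y)) + count (λ y → G (c , y) (c₀ , x))) ≡ n + n
      by-class 𝐴 rewrite out+in-own-class 𝐴 x | out+in-other-class 𝐵 𝐴 x (λ ()) | out+in-other-class 𝐶 𝐴 x (λ ()) | +-identityʳ n = refl
      by-class 𝐵 rewrite out+in-other-class 𝐴 𝐵 x (λ ()) | out+in-own-class 𝐵 x | out+in-other-class 𝐶 𝐵 x (λ ()) | +-identityʳ n = refl
      by-class 𝐶 rewrite out+in-other-class 𝐴 𝐶 x (λ ()) | out+in-other-class 𝐵 𝐶 x (λ ()) | out+in-own-class 𝐶 x | +-identityʳ n = refl

    outdeg≡n : ∀ v → outdeg G v ≡ n
    outdeg≡n v = +-cancel-double (trans (cong (outdeg G v +_) (proj₂ regular v)) (outdeg+indeg v))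
      where
      +-cancel-double : ∀ {a b} → a + a ≡ b + b → a ≡ b
      +-cancel-double {a} {b} eq = *-cancelˡ-≡ a b 2 (trans (cong (a +_) (+-identityʳ a)) (trans eq (cong (b +_) (sym (+-identityʳ b)))))

    indeg≡n : ∀ v → indeg G v ≡ n
    indeg≡n v = trans (sym (proj₂ regular v)) (outdeg≡n v)

  -- Approximating a regular tripartite tournament by a member of G_β

  swapBC : Permutation′ 3
  swapBC = swapᵖ 𝐵 𝐶

  -- A plays the part of V₁ and L marks ←V₁, so C = V₂ and B = V₃.  A vertex that is not good, or a pair
  -- joined by a bad edge, is an error; all other A–B and A–C edges already follow the pattern of G_β.
  module Approximation {n : ℕ} (G : Digraph n) (regular : IsRegularTripartiteTournament G)
    (L good : Vtx n → Bool) (bad : Vtx n → Vtx n → Bool)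
    (agree-AB : ∀ x y → good (𝐴 , x) ≡ true → good (𝐵 , y) ≡ true →
      bad (𝐴 , x) (𝐵 , y) ≡ false → bad (𝐵 , y) (𝐴 , x) ≡ false → G (𝐴 , x) (𝐵 , y) ≡ L (𝐴 , x))
    (agree-AC : ∀ x y → good (𝐴 , x) ≡ true → good (𝐶 , y) ≡ true →
      bad (𝐴 , x) (𝐶 , y) ≡ false → bad (𝐶 , y) (𝐴 , x) ≡ false → G (𝐴 , x) (𝐶 , y) ≡ not (L (𝐴 , x)))
    where

    open RegularTournament G regular

    k e S nonGoodA : ℕ
    k = count (λ x → L (𝐴 , x))
    e = countVV bad
    S = countV (not ∘ good)
    nonGoodA = count (λ a → not (good (𝐴 , a)))

    M₀ : Matrix n
    M₀ x y = G (𝐵 , x) (𝐶 , y)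

    k≤n : k ≤ n
    k≤n = count≤m _

    nonGood≤S : ∀ c → count (λ x → not (good (c , x))) ≤ S
    nonGood≤S = count≤countV (not ∘ good)

    bad-from≤e : ∀ c c′ → sumFin (λ x → count (λ a → bad (c , x) (c′ , a))) ≤ e
    bad-from≤e = sumFin-count≤countVV bad

    bad-to≤e : ∀ c c′ → sumFin (λ x → count (λ a → bad (c′ , a) (c , x))) ≤ e
    bad-to≤e c c′ = ≤-trans (sumFin-count≤countVV (λ u v → bad v u) c c′) (≤-reflexive (countVV-flip bad))

    -- s counts the B→C edges at a good vertex, f its edges with A: its n edges are shared between C and A,
    -- and on A they follow ¬ L up to errors.
    good-deviation : ∀ {s} (f P Q : Fin n → Bool) → s + count f ≡ n →
      (∀ a → (f a xor not (L (𝐴 , a))) ≡ true → not (good (𝐴 , a)) ≡ true ⊎ P a ≡ true ⊎ Q a ≡ true) →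
      ∣ s - k ∣ ≤ nonGoodA + (count P + count Q)
    good-deviation {s} f P Q s+f≡n mismatch = begin
      ∣ s - k ∣                                          ≡⟨ ∣-∣-balance s (count f) k _ (trans s+f≡n (sym (count+count-not _))) ⟩
      ∣ count f - count (λ a → not (L (𝐴 , a))) ∣        ≤⟨ ∣count-count∣≤count-xor f _ ⟩
      count (λ a → f a xor not (L (𝐴 , a)))              ≤⟨ count-∨-split (λ a d → reassoc (mismatch a d)) ⟩
      nonGoodA + count (λ a → P a ∨ Q a)                 ≤⟨ +-monoʳ-≤ nonGoodA (count-∨≤ P Q) ⟩
      nonGoodA + (count P + count Q)                     ∎
      where
      open ≤-Reasoning
      reassoc : ∀ {a} → _ → not (good (𝐴 , a)) ≡ true ⊎ (P a ∨ Q a) ≡ true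
      reassoc (inj₁ ng) = inj₁ ng
      reassoc {a} (inj₂ (inj₁ Pa)) rewrite Pa = inj₂ refl
      reassoc {a} (inj₂ (inj₂ Qa)) rewrite Qa = inj₂ (∨-zeroʳ (P a))

    rowError colError : Fin n → ℕ
    rowError x = n * χ (not (good (𝐵 , x))) + (nonGoodA + (count (λ a → bad (𝐵 , x) (𝐴 , a)) + count (λ a → bad (𝐴 , a) (𝐵 , x))))
    colError y = n * χ (not (good (𝐶 , y))) + (nonGoodA + (count (λ a → bad (𝐴 , a) (𝐶 , y)) + count (λ a → bad (𝐶 , y) (𝐴 , a))))

    rowSum-deviation : ∀ x → ∣ rowSum M₀ x - k ∣ ≤ rowError x
    rowSum-deviation x with good (𝐵 , x) in goodB
    ... | false = ≤-trans (∣-∣≤-bound (count≤m _) k≤n) (≤-trans (≤-reflexive (sym (*-identityʳ n))) (m≤m+n _ _))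
    ... | true = ≤-trans (good-deviation (λ a → G (𝐵 , x) (𝐴 , a)) _ _ outdeg-split mismatch) (m≤n+m _ (n * 0))
      where
      outdeg-split : rowSum M₀ x + count (λ a → G (𝐵 , x) (𝐴 , a)) ≡ n
      outdeg-split = begin
        rowSum M₀ x + count toA                          ≡⟨ +-comm (rowSum M₀ x) _ ⟩
        count toA + rowSum M₀ x                          ≡⟨ cong (count toA +_) (+-identityʳ (rowSum M₀ x)) ⟨
        count toA + (0 + (rowSum M₀ x + 0))              ≡⟨ cong (λ b → count toA + (b + (rowSum M₀ x + 0)))
                                                                 (count-none _ (no-edge-in-class 𝐵 x)) ⟨
        outdeg G (𝐵 , x)                                 ≡⟨ outdeg≡n (𝐵 , x) ⟩
        n                                                ∎
        where
        open ≡-Reasoning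
        toA : Fin n → Bool
        toA a = G (𝐵 , x) (𝐴 , a)
      mismatch : ∀ a → (G (𝐵 , x) (𝐴 , a) xor not (L (𝐴 , a))) ≡ true →
        not (good (𝐴 , a)) ≡ true ⊎ bad (𝐵 , x) (𝐴 , a) ≡ true ⊎ bad (𝐴 , a) (𝐵 , x) ≡ true
      mismatch a differs with good (𝐴 , a) in goodA | bad (𝐵 , x) (𝐴 , a) in bad₁ | bad (𝐴 , a) (𝐵 , x) in bad₂
      ... | false | _ | _ = inj₁ refl
      ... | true | true | _ = inj₂ (inj₁ refl)
      ... | true | false | true = inj₂ (inj₂ refl)
      ... | true | false | false with () ← trans (sym differs)
        (trans (cong (_xor not (L (𝐴 , a))) (trans (one-way 𝐵 𝐴 x a (λ ())) (cong not (agree-AB a x goodA goodB bad₂ bad₁))))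
               (xor-same (not (L (𝐴 , a)))))

    colSum-deviation : ∀ y → ∣ colSum M₀ y - k ∣ ≤ colError y
    colSum-deviation y with good (𝐶 , y) in goodC
    ... | false = ≤-trans (∣-∣≤-bound (count≤m _) k≤n) (≤-trans (≤-reflexive (sym (*-identityʳ n))) (m≤m+n _ _))
    ... | true = ≤-trans (good-deviation (λ a → G (𝐴 , a) (𝐶 , y)) _ _ indeg-split mismatch) (m≤n+m _ (n * 0))
      where
      indeg-split : colSum M₀ y + count (λ a → G (𝐴 , a) (𝐶 , y)) ≡ n
      indeg-split = begin
        colSum M₀ y + count fromA                        ≡⟨ +-comm (colSum M₀ y) _ ⟩
        count fromA + colSum M₀ y                        ≡⟨ cong (count fromA +_) (+-identityʳ (colSum M₀ y)) ⟨
        count fromA + (colSum M₀ y + (0 + 0))            ≡⟨ cong (λ c → count fromA + (colSum M₀ y + (c + 0)))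
                                                                 (count-none _ (λ z → no-edge-in-class 𝐶 z y)) ⟨
        indeg G (𝐶 , y)                                  ≡⟨ indeg≡n (𝐶 , y) ⟩
        n                                                ∎
        where
        open ≡-Reasoning
        fromA : Fin n → Bool
        fromA a = G (𝐴 , a) (𝐶 , y)
      mismatch : ∀ a → (G (𝐴 , a) (𝐶 , y) xor not (L (𝐴 , a))) ≡ true →
        not (good (𝐴 , a)) ≡ true ⊎ bad (𝐴 , a) (𝐶 , y) ≡ true ⊎ bad (𝐶 , y) (𝐴 , a) ≡ true
      mismatch a differs with good (𝐴 , a) in goodA | bad (𝐴 , a) (𝐶 , y) in bad₁ | bad (𝐶 , y) (𝐴 , a) in bad₂
      ... | false | _ | _ = inj₁ refl
      ... | true | true | _ = inj₂ (inj₁ refl)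
      ... | true | false | true = inj₂ (inj₂ refl)
      ... | true | false | false with () ← trans (sym differs)
        (trans (cong (_xor not (L (𝐴 , a))) (agree-AC a y goodA goodC bad₁ bad₂)) (xor-same (not (L (𝐴 , a)))))

    sumFin-distrib-+₄ : ∀ (a b c d : Fin n → ℕ) → sumFin (λ x → a x + (b x + (c x + d x))) ≡ sumFin a + (sumFin b + (sumFin c + sumFin d))
    sumFin-distrib-+₄ a b c d =
      trans (sumFin-distrib-+ a _) (cong (sumFin a +_) (trans (sumFin-distrib-+ b _) (cong (sumFin b +_) (sumFin-distrib-+ c d))))

    nonGood-weight≤ : ∀ c → sumFin (λ x → n * χ (not (good (c , x)))) ≤ n * S
    nonGood-weight≤ c = ≤-trans
      (≤-reflexive (trans (*-distribˡ-sumFin n (λ x → χ (not (good (c , x))))) (cong (n *_) (sym (count≡sumFin (λ x → not (good (c , x))))))))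
      (*-monoʳ-≤ n (nonGood≤S c))

    nonGoodA-weight≤ : sumFin {n} (λ _ → nonGoodA) ≤ n * S
    nonGoodA-weight≤ = ≤-trans (≤-reflexive (sumFin-const {n} nonGoodA)) (*-monoʳ-≤ n (nonGood≤S 𝐴))

    sideBound : ℕ
    sideBound = n * S + (n * S + (e + e))

    Dev≤ : Dev k M₀ ≤ sideBound + sideBound
    Dev≤ = +-mono-≤
      (≤-trans (sumFin-mono-≤ rowSum-deviation) (≤-trans (≤-reflexive (sumFin-distrib-+₄ _ (λ _ → nonGoodA) _ _))
        (+-mono-≤ (nonGood-weight≤ 𝐵) (+-mono-≤ nonGoodA-weight≤ (+-mono-≤ (bad-from≤e 𝐵 𝐴) (bad-to≤e 𝐵 𝐴))))))
      (≤-trans (sumFin-mono-≤ colSum-deviation) (≤-trans (≤-reflexive (sumFin-distrib-+₄ _ (λ _ → nonGoodA) _ _))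
        (+-mono-≤ (nonGood-weight≤ 𝐶) (+-mono-≤ nonGoodA-weight≤ (+-mono-≤ (bad-to≤e 𝐶 𝐴) (bad-from≤e 𝐶 𝐴))))))

    regularised : Σ (Matrix n) λ N → IsRegular k N × distance M₀ N ≤ 2 * Dev k M₀
    regularised = regularise k k≤n M₀

    N : Matrix n
    N = proj₁ regularised

    N-regular : IsRegular k N
    N-regular = proj₁ (proj₂ regularised)

    distance-M₀-N : distance M₀ N ≤ 2 * (sideBound + sideBound)
    distance-M₀-N = ≤-trans (proj₂ (proj₂ regularised)) (*-monoʳ-≤ 2 Dev≤)

    N-on-V₃×V₂ : Vtx n → Vtx n → Bool
    N-on-V₃×V₂ u v = N (proj₂ u) (proj₂ v)

    H : Digraph n
    H = Family.edges swapBC L N-on-V₃×V₂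

    H-valid : Family.Valid swapBC L N-on-V₃×V₂ k
    H-valid = bw-size , fw-size , V₃-degree , V₂-degree
      where
      open Family swapBC L N-on-V₃×V₂ using (in2; in3; fw; bw)
      none : count {n} (λ _ → false) ≡ 0
      none = count-none {n} _ (λ _ → refl)
      bw-size : countV bw ≡ k
      bw-size rewrite none = +-identityʳ k
      fw-size : countV fw ≡ n ∸ k
      fw-size rewrite none = trans (+-identityʳ _) (sym (trans (cong (_∸ k) (sym (count+count-not _))) (m+n∸m≡n k _)))
      V₃-degree : ∀ u → in3 u ≡ true → countV (λ v → in2 v ∧ N-on-V₃×V₂ u v) ≡ k
      V₃-degree (𝐵 , x) _ rewrite none = trans (+-identityʳ _) (proj₁ N-regular x)
      V₃-degree (𝐴 , _) ()
      V₃-degree (𝐶 , _) ()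
      V₂-degree : ∀ v → in2 v ≡ true → countV (λ u → in3 u ∧ N-on-V₃×V₂ u v) ≡ k
      V₂-degree (𝐶 , y) _ rewrite none = trans (+-identityʳ _) (proj₂ N-regular y)
      V₂-degree (𝐴 , _) ()
      V₂-degree (𝐵 , _) ()

    H-AA : ∀ x y → H (𝐴 , x) (𝐴 , y) ≡ false
    H-AA x y with L (𝐴 , x) | L (𝐴 , y)
    ... | true | true = refl
    ... | true | false = refl
    ... | false | true = refl
    ... | false | false = refl

    H-AB : ∀ x y → H (𝐴 , x) (𝐵 , y) ≡ L (𝐴 , x)
    H-AB x y with L (𝐴 , x)
    ... | true = refl
    ... | false = refl

    H-AC : ∀ x y → H (𝐴 , x) (𝐶 , y) ≡ not (L (𝐴 , x))
    H-AC x y with L (𝐴 , x)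
    ... | true = refl
    ... | false = refl

    H-BA : ∀ x y → H (𝐵 , x) (𝐴 , y) ≡ not (L (𝐴 , y))
    H-BA x y with L (𝐴 , y)
    ... | true = refl
    ... | false = refl

    H-BC : ∀ x y → H (𝐵 , x) (𝐶 , y) ≡ N x y
    H-BC x y with N x y
    ... | true = refl
    ... | false = refl

    H-CA : ∀ x y → H (𝐶 , x) (𝐴 , y) ≡ L (𝐴 , y)
    H-CA x y with L (𝐴 , y)
    ... | true = refl
    ... | false = refl

    H-CB : ∀ x y → H (𝐶 , x) (𝐵 , y) ≡ not (N y x)
    H-CB x y with N y x
    ... | true = refl
    ... | false = refl

    BC-difference : Vtx n → Vtx n → Bool
    BC-difference u v = (proj₁ u == 𝐵) ∧ (proj₁ v == 𝐶) ∧ (M₀ (proj₂ u) (proj₂ v) xor N (proj₂ u) (proj₂ v))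

    countVV-BC-difference : countVV BC-difference ≡ distance M₀ N
    countVV-BC-difference = trans (cong₂ _+_ no-row (cong₂ _+_ B-rows (cong₂ _+_ no-row refl))) (+-identityʳ _)
      where
      no-row : sumFin {n} (λ x → countV {n} (λ _ → false)) ≡ 0
      no-row = trans (sumFin-cong {n} (λ _ → sumFin-cong {3} {g = λ _ → 0} (λ _ → count-none {n} _ (λ _ → refl))))
                     (trans (sumFin-const {n} 0) (*-zeroʳ n))
      B-rows : sumFin (λ x → countV (BC-difference (𝐵 , x))) ≡ distance M₀ N
      B-rows = sumFin-cong (λ x → trans (cong (λ z → z + (z + (count (λ y → M₀ x y xor N x y) + 0))) (count-none {n} _ (λ _ → refl)))
                                        (+-identityʳ _))


    good-mismatch : ∀ c c′ x y → good (c , x) ≡ true → good (c′ , y) ≡ true → bad (c , x) (c′ , y) ≡ false → bad (c′ , y) (c , x) ≡ false →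
      (G (c , x) (c′ , y) xor H (c , x) (c′ , y)) ≡ true → (BC-difference (c , x) (c′ , y) ∨ BC-difference (c′ , y) (c , x)) ≡ true
    good-mismatch 𝐴 𝐴 x y _ _ _ _ d = ⊥-elim (≡⇒xor≢true (trans (no-edge-in-class 𝐴 x y) (sym (H-AA x y))) d)
    good-mismatch 𝐴 𝐵 x y g g′ b b′ d = ⊥-elim (≡⇒xor≢true (trans (agree-AB x y g g′ b b′) (sym (H-AB x y))) d)
    good-mismatch 𝐴 𝐶 x y g g′ b b′ d = ⊥-elim (≡⇒xor≢true (trans (agree-AC x y g g′ b b′) (sym (H-AC x y))) d)
    good-mismatch 𝐵 𝐴 x y g g′ b b′ d =
      ⊥-elim (≡⇒xor≢true (trans (one-way 𝐵 𝐴 x y (λ ())) (trans (cong not (agree-AB y x g′ g b′ b)) (sym (H-BA x y)))) d)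
    good-mismatch 𝐵 𝐵 x y _ _ _ _ d = ⊥-elim (≡⇒xor≢true (no-edge-in-class 𝐵 x y) d)
    good-mismatch 𝐵 𝐶 x y _ _ _ _ d = trans (∨-identityʳ _) (subst (λ h → (M₀ x y xor h) ≡ true) (H-BC x y) d)
    good-mismatch 𝐶 𝐴 x y g g′ b b′ d =
      ⊥-elim (≡⇒xor≢true (trans (one-way 𝐶 𝐴 x y (λ ())) (trans (cong not (agree-AC y x g′ g b′ b))
                                                             (trans (not-involutive _) (sym (H-CA x y))))) d)
    good-mismatch 𝐶 𝐵 x y _ _ _ _ d =
      trans (sym (xor-annihilates-not (M₀ y x) (N y x))) (subst₂ (λ a b → (a xor b) ≡ true) (one-way 𝐶 𝐵 x y (λ ())) (H-CB x y) d)
    good-mismatch 𝐶 𝐶 x y _ _ _ _ d = ⊥-elim (≡⇒xor≢true (no-edge-in-class 𝐶 x y) d)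

    Error : Vtx n → Vtx n → Bool
    Error u v = bad u v ∨ (bad v u ∨ (not (good u) ∨ (not (good v) ∨ (BC-difference u v ∨ BC-difference v u))))

    mismatch⇒Error : ∀ u v → (G u v xor H u v) ≡ true → Error u v ≡ true
    mismatch⇒Error (c , x) (c′ , y) d
      with bad (c , x) (c′ , y) in b | bad (c′ , y) (c , x) in b′ | good (c , x) in g | good (c′ , y) in g′
    ... | true | _ | _ | _ = refl
    ... | false | true | _ | _ = refl
    ... | false | false | false | _ = refl
    ... | false | false | true | false = refl
    ... | false | false | true | true = good-mismatch c c′ x y g g′ b b′ d

    edgeSymDiff≤ : edgeSymDiff G H ≤ e + (e + (3 * n * S + (3 * n * S + (distance M₀ N + distance M₀ N))))
    edgeSymDiff≤ = ≤-trans (countVV-mono mismatch⇒Error)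
      (countVV-∨-≤ bad E₂ ≤-refl
      (countVV-∨-≤ (λ u v → bad v u) E₃ (≤-reflexive (countVV-flip bad))
      (countVV-∨-≤ (λ u v → not (good u)) E₄ (≤-reflexive (countVV-source (not ∘ good)))
      (countVV-∨-≤ (λ u v → not (good v)) E₅ (≤-reflexive (countVV-target (not ∘ good)))
      (countVV-∨-≤ BC-difference (λ u v → BC-difference v u) (≤-reflexive countVV-BC-difference)
                   (≤-reflexive (trans (countVV-flip BC-difference) countVV-BC-difference)))))))
      where
      E₂ E₃ E₄ E₅ : Vtx n → Vtx n → Bool
      E₅ u v = BC-difference u v ∨ BC-difference v u
      E₄ u v = not (good v) ∨ E₅ u v
      E₃ u v = not (good u) ∨ E₄ u v
      E₂ u v = bad v u ∨ E₃ u v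

    approximation : Σ (Digraph n) λ H → InFamily k H × edgeSymDiff G H ≤ 18 * e + 22 * (n * S)
    approximation = H , (swapBC , L , N-on-V₃×V₂ , H-valid , (λ u v → refl)) , ≤-trans edgeSymDiff≤ (≤-trans weaken (≤-reflexive (collect e (n * S))))
      where
      open +-*-Solver
      weaken : e + (e + (3 * n * S + (3 * n * S + (distance M₀ N + distance M₀ N))))
             ≤ e + (e + (3 * (n * S) + (3 * (n * S) + (2 * (sideBound + sideBound) + 2 * (sideBound + sideBound)))))
      weaken = +-monoʳ-≤ e (+-monoʳ-≤ e (+-mono-≤ (≤-reflexive (*-assoc 3 n S))
                 (+-mono-≤ (≤-reflexive (*-assoc 3 n S)) (+-mono-≤ distance-M₀-N distance-M₀-N))))
      collect : ∀ e X → e + (e + (3 * X + (3 * X + (2 * ((X + (X + (e + e))) + (X + (X + (e + e))))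
                                                  + 2 * ((X + (X + (e + e))) + (X + (X + (e + e))))))))
                        ≡ 18 * e + 22 * X
      collect = solve 2 (λ e X → e :+ (e :+ (con 3 :* X :+ (con 3 :* X :+ (con 2 :* ((X :+ (X :+ (e :+ e))) :+ (X :+ (X :+ (e :+ e))))
                                           :+ con 2 :* ((X :+ (X :+ (e :+ e))) :+ (X :+ (X :+ (e :+ e)))))))) := con 18 :* e :+ con 22 :* X) refl

  -- The partition V₁₁ ∪ V₁₂ ∪ V₂₁ ∪ V₂₂

  -- A cell (i , j) stands for V_{i+1,j+1}.
  Cell : Set
  Cell = Fin 2 × Fin 2

  pattern c₁₁ = zero , zero
  pattern c₁₂ = zero , suc zero
  pattern c₂₁ = suc zero , zero
  pattern c₂₂ = suc zero , suc zero

  inV₁₁ inV₂₂ inAcell inBcell inCcell : Cell → Bool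
  inV₁₁ a = proj₁ a == zero ∧ proj₂ a == zero
  inV₂₂ a = proj₁ a == suc zero ∧ proj₂ a == suc zero
  inAcell a = inV₁₁ a ∨ inV₂₂ a
  inBcell a = proj₁ a == zero ∧ proj₂ a == suc zero
  inCcell a = proj₁ a == suc zero ∧ proj₂ a == zero

  crossing : Cell → Cell → Bool
  crossing a b = (proj₁ a == zero ∧ proj₂ b == suc zero) ∨ (proj₁ a == suc zero ∧ proj₂ b == zero)

  goodCell : Fin 3 → Cell → Bool
  goodCell 𝐴 a = inAcell a
  goodCell 𝐵 a = inBcell a
  goodCell 𝐶 a = inCcell a

  -- g is the direction of an edge from A to B; the edge that is present must not cross.
  agree-AB-cell : ∀ a b g → goodCell 𝐴 a ≡ true → goodCell 𝐵 b ≡ true →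
    (crossing a b ∧ g) ≡ false → (crossing b a ∧ not g) ≡ false → g ≡ inV₂₂ a
  agree-AB-cell c₁₁ c₁₂ false _ _ _ _ = refl
  agree-AB-cell c₁₁ c₁₂ true _ _ () _
  agree-AB-cell c₂₂ c₁₂ true _ _ _ _ = refl
  agree-AB-cell c₂₂ c₁₂ false _ _ _ ()
  agree-AB-cell c₁₂ _ _ () _ _ _
  agree-AB-cell c₂₁ _ _ () _ _ _
  agree-AB-cell c₁₁ c₁₁ _ _ () _ _
  agree-AB-cell c₁₁ c₂₁ _ _ () _ _
  agree-AB-cell c₁₁ c₂₂ _ _ () _ _
  agree-AB-cell c₂₂ c₁₁ _ _ () _ _
  agree-AB-cell c₂₂ c₂₁ _ _ () _ _
  agree-AB-cell c₂₂ c₂₂ _ _ () _ _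

  agree-AC-cell : ∀ a b g → goodCell 𝐴 a ≡ true → goodCell 𝐶 b ≡ true →
    (crossing a b ∧ g) ≡ false → (crossing b a ∧ not g) ≡ false → g ≡ not (inV₂₂ a)
  agree-AC-cell c₁₁ c₂₁ true _ _ _ _ = refl
  agree-AC-cell c₁₁ c₂₁ false _ _ _ ()
  agree-AC-cell c₂₂ c₂₁ false _ _ _ _ = refl
  agree-AC-cell c₂₂ c₂₁ true _ _ () _
  agree-AC-cell c₁₂ _ _ () _ _ _
  agree-AC-cell c₂₁ _ _ () _ _ _
  agree-AC-cell c₁₁ c₁₁ _ _ () _ _
  agree-AC-cell c₁₁ c₁₂ _ _ () _ _
  agree-AC-cell c₁₁ c₂₂ _ _ () _ _
  agree-AC-cell c₂₂ c₁₁ _ _ () _ _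
  agree-AC-cell c₂₂ c₁₂ _ _ () _ _
  agree-AC-cell c₂₂ c₂₂ _ _ () _ _

  not-good-misplaced : ∀ c a → not (goodCell c a) ≡ true →
    ((c == 𝐴) xor inAcell a) ≡ true ⊎ ((c == 𝐵) xor inBcell a) ≡ true ⊎ ((c == 𝐶) xor inCcell a) ≡ true
  not-good-misplaced 𝐴 c₁₂ _ = inj₁ refl
  not-good-misplaced 𝐴 c₂₁ _ = inj₁ refl
  not-good-misplaced 𝐵 c₁₁ _ = inj₂ (inj₁ refl)
  not-good-misplaced 𝐵 c₂₁ _ = inj₂ (inj₁ refl)
  not-good-misplaced 𝐵 c₂₂ _ = inj₂ (inj₁ refl)
  not-good-misplaced 𝐶 c₁₁ _ = inj₂ (inj₂ refl)
  not-good-misplaced 𝐶 c₁₂ _ = inj₂ (inj₂ refl)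
  not-good-misplaced 𝐶 c₂₂ _ = inj₂ (inj₂ refl)
  not-good-misplaced 𝐴 c₁₁ ()
  not-good-misplaced 𝐴 c₂₂ ()
  not-good-misplaced 𝐵 c₁₂ ()
  not-good-misplaced 𝐶 c₂₁ ()

  module Partition {n : ℕ} (G : Digraph n) (regular : IsRegularTripartiteTournament G) (p : Vtx n → Cell) where

    open RegularTournament G regular

    good : Vtx n → Bool
    good v = goodCell (proj₁ v) (p v)

    bad : Vtx n → Vtx n → Bool
    bad u v = crossing (p u) (p v) ∧ G u v

    approximation : Σ (Digraph n) λ H → InFamily (count (λ x → inV₂₂ (p (𝐴 , x)))) H
                                        × edgeSymDiff G H ≤ 18 * countVV bad + 22 * (n * countV (not ∘ good))
    approximation = Approximation.approximation G regular (inV₂₂ ∘ p) good bad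
      (λ x y gx gy b b′ → agree-AB-cell (p (𝐴 , x)) (p (𝐵 , y)) _ gx gy b (subst (λ h → (crossing (p (𝐵 , y)) (p (𝐴 , x)) ∧ h) ≡ false) (one-way 𝐵 𝐴 y x (λ ())) b′))
      (λ x y gx gy b b′ → agree-AC-cell (p (𝐴 , x)) (p (𝐶 , y)) _ gx gy b (subst (λ h → (crossing (p (𝐶 , y)) (p (𝐴 , x)) ∧ h) ≡ false) (one-way 𝐶 𝐴 y x (λ ())) b′))

    crossingEdges misplacedA misplacedB misplacedC : ℕ
    crossingEdges = eG G (λ u → proj₁ (p u) == zero) (λ v → proj₂ (p v) == suc zero)
                  + eG G (λ u → proj₁ (p u) == suc zero) (λ v → proj₂ (p v) == zero)
    misplacedA = symDiff inA (inAcell ∘ p)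
    misplacedB = symDiff inB (inBcell ∘ p)
    misplacedC = symDiff inC (inCcell ∘ p)

    countVV-bad≤ : countVV bad ≤ crossingEdges
    countVV-bad≤ = ≤-trans (≤-reflexive (countVV-cong distribute))
      (countVV-∨ (λ u v → (proj₁ (p u) == zero) ∧ (proj₂ (p v) == suc zero) ∧ G u v)
                 (λ u v → (proj₁ (p u) == suc zero) ∧ (proj₂ (p v) == zero) ∧ G u v))
      where
      distribute : ∀ u v → bad u v ≡ ((proj₁ (p u) == zero) ∧ (proj₂ (p v) == suc zero) ∧ G u v)
                                     ∨ ((proj₁ (p u) == suc zero) ∧ (proj₂ (p v) == zero) ∧ G u v)
      distribute u v = trans (∧-distribʳ-∨ (G u v) (x₁ ∧ y₂) (x₂ ∧ y₁)) (cong₂ _∨_ (∧-assoc x₁ y₂ (G u v)) (∧-assoc x₂ y₁ (G u v)))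
        where
        x₁ x₂ y₁ y₂ : Bool
        x₁ = proj₁ (p u) == zero
        x₂ = proj₁ (p u) == suc zero
        y₁ = proj₂ (p v) == zero
        y₂ = proj₂ (p v) == suc zero

    countV-not-good≤ : countV (not ∘ good) ≤ misplacedA + (misplacedB + misplacedC)
    countV-not-good≤ = ≤-trans (countV-∨-split (λ v → (proj₁ v == 𝐴) xor inAcell (p v)) (λ v → ((proj₁ v == 𝐵) xor inBcell (p v)) ∨ ((proj₁ v == 𝐶) xor inCcell (p v))) split)
      (+-monoʳ-≤ misplacedA (countV-∨-split (λ v → (proj₁ v == 𝐵) xor inBcell (p v)) (λ v → (proj₁ v == 𝐶) xor inCcell (p v))
                                            (λ v → ∨-split ((proj₁ v == 𝐵) xor inBcell (p v)))))
      where
      ∨-split : ∀ a {b} → (a ∨ b) ≡ true → a ≡ true ⊎ b ≡ true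
      ∨-split true _ = inj₁ refl
      ∨-split false b = inj₂ b
      split : ∀ v → not (good v) ≡ true →
        ((proj₁ v == 𝐴) xor inAcell (p v)) ≡ true ⊎ (((proj₁ v == 𝐵) xor inBcell (p v)) ∨ ((proj₁ v == 𝐶) xor inCcell (p v))) ≡ true
      split v ng with not-good-misplaced (proj₁ v) (p v) ng
      ... | inj₁ inA = inj₁ inA
      ... | inj₂ (inj₁ inB) rewrite inB = inj₂ refl
      ... | inj₂ (inj₂ inC) rewrite inC = inj₂ (∨-zeroʳ _)

  -- Exchanging the roles of B and C

  swapBC-involutive : ∀ c → swapBC ⟨$⟩ʳ (swapBC ⟨$⟩ʳ c) ≡ c
  swapBC-involutive 𝐴 = refl
  swapBC-involutive 𝐵 = refl
  swapBC-involutive 𝐶 = refl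

  relabel : ∀ {n} → Vtx n → Vtx n
  relabel (c , x) = swapBC ⟨$⟩ʳ c , x

  relabel-involutive : ∀ {n} (v : Vtx n) → relabel (relabel v) ≡ v
  relabel-involutive (c , x) = cong (_, x) (swapBC-involutive c)

  sumFin-swapBC : (g : Fin 3 → ℕ) → sumFin (λ c → g (swapBC ⟨$⟩ʳ c)) ≡ sumFin g
  sumFin-swapBC g = cong (g 𝐴 +_) (trans (sym (+-assoc (g 𝐶) (g 𝐵) 0)) (trans (cong (_+ 0) (+-comm (g 𝐶) (g 𝐵))) (+-assoc (g 𝐵) (g 𝐶) 0)))

  countV-relabel : ∀ {n} (f : Vtx n → Bool) → countV (f ∘ relabel) ≡ countV f
  countV-relabel f = sumFin-swapBC (λ c → count (λ x → f (c , x)))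

  countVV-relabel : ∀ {n} (f : Vtx n → Vtx n → Bool) → countVV (λ u v → f (relabel u) (relabel v)) ≡ countVV f
  countVV-relabel {n} f = trans (sumFin-cong (λ c → sumFin-cong (λ x → countV-relabel (f (relabel (c , x))))))
                                (sumFin-swapBC (λ c → sumFin {n} (λ x → countV (f (c , x)))))

  relabel-regular : ∀ {n} {G : Digraph n} → IsRegularTripartiteTournament G →
    IsRegularTripartiteTournament (λ u v → G (relabel u) (relabel v))
  relabel-regular {G = G} (tournament , balanced) =
    (λ u v → (λ same → proj₁ (tournament (relabel u) (relabel v)) (cong (swapBC ⟨$⟩ʳ_) same))
           , (λ differ → proj₂ (tournament (relabel u) (relabel v)) (differ ∘ swap-injective)))
    , (λ v → trans (countV-relabel (G (relabel v))) (trans (balanced (relabel v)) (sym (countV-relabel (λ w → G w (relabel v))))))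
    where
    swap-injective : ∀ {a b} → swapBC ⟨$⟩ʳ a ≡ swapBC ⟨$⟩ʳ b → a ≡ b
    swap-injective {a} {b} eq = trans (sym (swapBC-involutive a)) (trans (cong (swapBC ⟨$⟩ʳ_) eq) (swapBC-involutive b))

  InFamily-relabel : ∀ {n k} {H : Digraph n} → InFamily k H → InFamily k (λ u v → H (relabel u) (relabel v))
  InFamily-relabel (σ , L , M , (bw-size , fw-size , V₃-degree , V₂-degree) , H≡edges) =
    swapBC ∘ₚ σ , L ∘ relabel , (λ u v → M (relabel u) (relabel v)) ,
    ( trans (countV-relabel bw) bw-size , trans (countV-relabel fw) fw-size
    , (λ u in₃ → trans (countV-relabel (λ v → in2 v ∧ M (relabel u) v)) (V₃-degree (relabel u) in₃))
    , (λ v in₂ → trans (countV-relabel (λ u → in3 u ∧ M u (relabel v))) (V₂-degree (relabel v) in₂)) ) ,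
    (λ u v → H≡edges (relabel u) (relabel v))
    where open Family σ L M using (in2; in3; fw; bw)

  flipCell : Cell → Cell
  flipCell (i , j) = flipIndex i , flipIndex j
    where
    flipIndex : Fin 2 → Fin 2
    flipIndex zero = suc zero
    flipIndex (suc zero) = zero

  inV₂₂-flip : ∀ a → inV₂₂ (flipCell a) ≡ inV₁₁ a
  inV₂₂-flip c₁₁ = refl
  inV₂₂-flip c₁₂ = refl
  inV₂₂-flip c₂₁ = refl
  inV₂₂-flip c₂₂ = refl

  goodCell-flip : ∀ c a → goodCell c (flipCell a) ≡ goodCell (swapBC ⟨$⟩ʳ c) a
  goodCell-flip 𝐴 c₁₁ = refl
  goodCell-flip 𝐴 c₁₂ = refl
  goodCell-flip 𝐴 c₂₁ = refl
  goodCell-flip 𝐴 c₂₂ = refl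
  goodCell-flip 𝐵 c₁₁ = refl
  goodCell-flip 𝐵 c₁₂ = refl
  goodCell-flip 𝐵 c₂₁ = refl
  goodCell-flip 𝐵 c₂₂ = refl
  goodCell-flip 𝐶 c₁₁ = refl
  goodCell-flip 𝐶 c₁₂ = refl
  goodCell-flip 𝐶 c₂₁ = refl
  goodCell-flip 𝐶 c₂₂ = refl

  crossing-flip : ∀ a b → crossing (flipCell a) (flipCell b) ≡ crossing a b
  crossing-flip (zero , _) (_ , zero) = refl
  crossing-flip (zero , _) (_ , suc zero) = refl
  crossing-flip (suc zero , _) (_ , zero) = refl
  crossing-flip (suc zero , _) (_ , suc zero) = refl

  -- With B and C exchanged and both halves of each cell index flipped, V₁₁ plays the part of V₂₂.
  module SwappedPartition {n : ℕ} (G : Digraph n) (regular : IsRegularTripartiteTournament G) (p : Vtx n → Cell) where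

    open Partition G regular p using (good; bad)
    module Swapped = Partition (λ u v → G (relabel u) (relabel v)) (relabel-regular regular) (flipCell ∘ p ∘ relabel)

    approximation : Σ (Digraph n) λ H → InFamily (count (λ x → inV₁₁ (p (𝐴 , x)))) H
                                        × edgeSymDiff G H ≤ 18 * countVV bad + 22 * (n * countV (not ∘ good))
    approximation =
      let H′ , family , bound = Swapped.approximation in
      (λ u v → H′ (relabel u) (relabel v)) ,
      subst (λ k → InFamily k (λ u v → H′ (relabel u) (relabel v))) (count-cong (λ x → inV₂₂-flip (p (𝐴 , x)))) (InFamily-relabel family) ,
      ≤-trans (≤-reflexive (trans (countVV-cong (λ u v → cong (_xor H′ (relabel u) (relabel v))
                                                           (sym (cong₂ G (relabel-involutive u) (relabel-involutive v)))))
                                  (countVV-relabel (λ u v → G (relabel u) (relabel v) xor H′ u v))))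
      (≤-trans bound (≤-reflexive (cong₂ (λ a b → 18 * a + 22 * (n * b)) same-bad same-good)))
      where
      same-bad : countVV Swapped.bad ≡ countVV bad
      same-bad = trans (countVV-cong (λ u v → cong (_∧ G (relabel u) (relabel v)) (crossing-flip (p (relabel u)) (p (relabel v)))))
                       (countVV-relabel bad)
      same-good : countV (not ∘ Swapped.good) ≡ countV (not ∘ good)
      same-good = trans (countV-cong (λ v → cong not (goodCell-flip (proj₁ v) (p (relabel v))))) (countV-relabel (not ∘ good))

  -- Passing to rationals

  module _ where
    open import Data.Integer using (+_)
    import Data.Integer as ℤ
    import Data.Integer.Properties as ℤ
    open import Data.Rational using (ℚ; 0ℚ; 1ℚ; mkℚ) renaming (_+_ to _+ℚ_; _*_ to _*ℚ_; _≤_ to _≤ℚ_)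
    open import Data.Rational.Properties as ℚ using (/-cong; normalize-coprime; normalize-nonNeg; nonNegative⁻¹; *-monoˡ-≤-nonNeg)
    import Data.Nat.Coprimality as Coprime
    import Data.Rational.Solver as ℚ-Solver

    ⟦⟧-suc : ∀ m → ⟦ suc m ⟧ ≡ 1ℚ +ℚ ⟦ m ⟧
    ⟦⟧-suc m = begin
      ⟦ suc m ⟧                              ≡⟨ /-cong {p₁ = + suc m} {1} {+ 1 ℤ.* + 1 ℤ.+ + m ℤ.* + 1} {1 * 1}
                                                        (cong (λ z → + 1 ℤ.+ z) (sym (ℤ.*-identityʳ (+ m)))) refl ⟩
      1ℚ +ℚ mkℚ (+ m) 0 m/1-coprime          ≡⟨ cong (1ℚ +ℚ_) (normalize-coprime m/1-coprime) ⟨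
      1ℚ +ℚ ⟦ m ⟧                            ∎
      where
      open ≡-Reasoning
      m/1-coprime : Coprime.Coprime m 1
      m/1-coprime = Coprime.sym (Coprime.1-coprimeTo m)

    ⟦⟧-homo-+ : ∀ a b → ⟦ a + b ⟧ ≡ ⟦ a ⟧ +ℚ ⟦ b ⟧
    ⟦⟧-homo-+ zero b = sym (ℚ.+-identityˡ ⟦ b ⟧)
    ⟦⟧-homo-+ (suc a) b = begin
      ⟦ suc (a + b) ⟧                 ≡⟨ ⟦⟧-suc (a + b) ⟩
      1ℚ +ℚ ⟦ a + b ⟧                 ≡⟨ cong (1ℚ +ℚ_) (⟦⟧-homo-+ a b) ⟩
      1ℚ +ℚ (⟦ a ⟧ +ℚ ⟦ b ⟧)          ≡⟨ ℚ.+-assoc 1ℚ ⟦ a ⟧ ⟦ b ⟧ ⟨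
      (1ℚ +ℚ ⟦ a ⟧) +ℚ ⟦ b ⟧          ≡⟨ cong (_+ℚ ⟦ b ⟧) (⟦⟧-suc a) ⟨
      ⟦ suc a ⟧ +ℚ ⟦ b ⟧              ∎
      where open ≡-Reasoning

    ⟦⟧-homo-* : ∀ a b → ⟦ a * b ⟧ ≡ ⟦ a ⟧ *ℚ ⟦ b ⟧
    ⟦⟧-homo-* zero b = sym (ℚ.*-zeroˡ ⟦ b ⟧)
    ⟦⟧-homo-* (suc a) b = begin
      ⟦ b + a * b ⟧                   ≡⟨ ⟦⟧-homo-+ b (a * b) ⟩
      ⟦ b ⟧ +ℚ ⟦ a * b ⟧              ≡⟨ cong₂ _+ℚ_ (sym (ℚ.*-identityˡ ⟦ b ⟧)) (⟦⟧-homo-* a b) ⟩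
      1ℚ *ℚ ⟦ b ⟧ +ℚ ⟦ a ⟧ *ℚ ⟦ b ⟧   ≡⟨ ℚ.*-distribʳ-+ ⟦ b ⟧ 1ℚ ⟦ a ⟧ ⟨
      (1ℚ +ℚ ⟦ a ⟧) *ℚ ⟦ b ⟧          ≡⟨ cong (_*ℚ ⟦ b ⟧) (⟦⟧-suc a) ⟨
      ⟦ suc a ⟧ *ℚ ⟦ b ⟧              ∎
      where open ≡-Reasoning

    ⟦⟧-mono-≤ : ∀ {a b} → a ≤ b → ⟦ a ⟧ ≤ℚ ⟦ b ⟧
    ⟦⟧-mono-≤ {a} {b} a≤b = begin
      ⟦ a ⟧                    ≡⟨ ℚ.+-identityʳ ⟦ a ⟧ ⟨
      ⟦ a ⟧ +ℚ 0ℚ              ≤⟨ ℚ.+-monoʳ-≤ ⟦ a ⟧ (nonNegative⁻¹ ⟦ b ∸ a ⟧ {{normalize-nonNeg (b ∸ a) 1}}) ⟩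
      ⟦ a ⟧ +ℚ ⟦ b ∸ a ⟧       ≡⟨ trans (sym (⟦⟧-homo-+ a (b ∸ a))) (cong ⟦_⟧ (m+[n∸m]≡n a≤b)) ⟩
      ⟦ b ⟧                    ∎
      where open ℚ.≤-Reasoning

    -- 90 = 10·3² and 270·3 = 90·3², so the weights of x and of a + b + c are exact.
    rational-bound : ∀ n x a b c (ε₁ ε₂ : ℚ) → ⟦ x ⟧ ≤ℚ ε₁ *ℚ ⟦ n ⟧ *ℚ ⟦ n ⟧ →
      ⟦ a ⟧ ≤ℚ ε₂ *ℚ ⟦ n ⟧ → ⟦ b ⟧ ≤ℚ ε₂ *ℚ ⟦ n ⟧ → ⟦ c ⟧ ≤ℚ ε₂ *ℚ ⟦ n ⟧ →
      ⟦ 90 * x + 270 * (n * (a + (b + c))) ⟧ ≤ℚ (⟦ 10 ⟧ *ℚ ε₁ +ℚ ⟦ 90 ⟧ *ℚ ε₂) *ℚ ⟦ 3 * n ⟧ *ℚ ⟦ 3 * n ⟧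
    rational-bound n x a b c ε₁ ε₂ x≤ a≤ b≤ c≤ = begin
      ⟦ 90 * x + 270 * (n * (a + (b + c))) ⟧
        ≡⟨ trans (⟦⟧-homo-+ (90 * x) (270 * (n * (a + (b + c))))) (cong₂ _+ℚ_ (⟦⟧-homo-* 90 x) (trans (⟦⟧-homo-* 270 (n * (a + (b + c))))
             (cong (⟦ 270 ⟧ *ℚ_) (trans (⟦⟧-homo-* n (a + (b + c))) (cong (⟦ n ⟧ *ℚ_)
               (trans (⟦⟧-homo-+ a (b + c)) (cong (⟦ a ⟧ +ℚ_) (⟦⟧-homo-+ b c)))))))) ⟩
      ⟦ 90 ⟧ *ℚ ⟦ x ⟧ +ℚ ⟦ 270 ⟧ *ℚ (⟦ n ⟧ *ℚ (⟦ a ⟧ +ℚ (⟦ b ⟧ +ℚ ⟦ c ⟧)))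
        ≤⟨ ℚ.+-mono-≤ (*-monoˡ-≤-nonNeg ⟦ 90 ⟧ {{normalize-nonNeg 90 1}} x≤)
             (*-monoˡ-≤-nonNeg ⟦ 270 ⟧ {{normalize-nonNeg 270 1}} (*-monoˡ-≤-nonNeg ⟦ n ⟧ {{normalize-nonNeg n 1}}
               (ℚ.+-mono-≤ a≤ (ℚ.+-mono-≤ b≤ c≤)))) ⟩
      ⟦ 90 ⟧ *ℚ (ε₁ *ℚ ⟦ n ⟧ *ℚ ⟦ n ⟧) +ℚ ⟦ 270 ⟧ *ℚ (⟦ n ⟧ *ℚ (ε₂ *ℚ ⟦ n ⟧ +ℚ (ε₂ *ℚ ⟦ n ⟧ +ℚ ε₂ *ℚ ⟦ n ⟧)))
        ≡⟨ identity ε₁ ε₂ ⟦ n ⟧ ⟨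
      (⟦ 10 ⟧ *ℚ ε₁ +ℚ ⟦ 90 ⟧ *ℚ ε₂) *ℚ (⟦ 3 ⟧ *ℚ ⟦ n ⟧) *ℚ (⟦ 3 ⟧ *ℚ ⟦ n ⟧)
        ≡⟨ cong₂ (λ s t → (⟦ 10 ⟧ *ℚ ε₁ +ℚ ⟦ 90 ⟧ *ℚ ε₂) *ℚ s *ℚ t) (⟦⟧-homo-* 3 n) (⟦⟧-homo-* 3 n) ⟨
      (⟦ 10 ⟧ *ℚ ε₁ +ℚ ⟦ 90 ⟧ *ℚ ε₂) *ℚ ⟦ 3 * n ⟧ *ℚ ⟦ 3 * n ⟧
        ∎
      where
      open ℚ.≤-Reasoning
      open ℚ-Solver.+-*-Solver using (solve; _:+_; _:*_; _:=_; con)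
      identity : ∀ (ε₁ ε₂ N : ℚ) → (⟦ 10 ⟧ *ℚ ε₁ +ℚ ⟦ 90 ⟧ *ℚ ε₂) *ℚ (⟦ 3 ⟧ *ℚ N) *ℚ (⟦ 3 ⟧ *ℚ N)
                                  ≡ ⟦ 90 ⟧ *ℚ (ε₁ *ℚ N *ℚ N) +ℚ ⟦ 270 ⟧ *ℚ (N *ℚ (ε₂ *ℚ N +ℚ (ε₂ *ℚ N +ℚ ε₂ *ℚ N)))
      identity = solve 3 (λ e₁ e₂ N → (con ⟦ 10 ⟧ :* e₁ :+ con ⟦ 90 ⟧ :* e₂) :* (con ⟦ 3 ⟧ :* N) :* (con ⟦ 3 ⟧ :* N)
                                     := con ⟦ 90 ⟧ :* (e₁ :* N :* N) :+ con ⟦ 270 ⟧ :* (N :* (e₂ :* N :+ (e₂ :* N :+ e₂ :* N)))) refl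

    module _ {n : ℕ} (G : Digraph n) (regular : IsRegularTripartiteTournament G) (p : Vtx n → Cell) where

      open Partition G regular p

      close-from-errors : ∀ {H} ε₁ ε₂ → edgeSymDiff G H ≤ 18 * countVV bad + 22 * (n * countV (not ∘ good)) →
        ⟦ crossingEdges ⟧ ≤ℚ ε₁ *ℚ ⟦ n ⟧ *ℚ ⟦ n ⟧ →
        ⟦ misplacedA ⟧ ≤ℚ ε₂ *ℚ ⟦ n ⟧ → ⟦ misplacedB ⟧ ≤ℚ ε₂ *ℚ ⟦ n ⟧ → ⟦ misplacedC ⟧ ≤ℚ ε₂ *ℚ ⟦ n ⟧ →
        Close (⟦ 10 ⟧ *ℚ ε₁ +ℚ ⟦ 90 ⟧ *ℚ ε₂) G H
      close-from-errors {H} ε₁ ε₂ errors crossing≤ A≤ B≤ C≤ =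
        ℚ.≤-trans (⟦⟧-mono-≤ weaken) (rational-bound n crossingEdges misplacedA misplacedB misplacedC ε₁ ε₂ crossing≤ A≤ B≤ C≤)
        where
        weaken : edgeSymDiff G H ≤ 90 * crossingEdges + 270 * (n * (misplacedA + (misplacedB + misplacedC)))
        weaken = ≤-trans errors (+-mono-≤ (*-mono-≤ (m≤m+n 18 72) countVV-bad≤)
                                          (*-mono-≤ (m≤m+n 22 248) (*-monoʳ-≤ n countV-not-good≤)))

  count-V₁₁+count-V₂₂≤n : ∀ {n} (p : Fin n → Cell) → count (inV₁₁ ∘ p) + count (inV₂₂ ∘ p) ≤ n
  count-V₁₁+count-V₂₂≤n {n} p = begin
    count (inV₁₁ ∘ p) + count (inV₂₂ ∘ p)                                         ≡⟨ count-∨+count-∧ (inV₁₁ ∘ p) (inV₂₂ ∘ p) ⟨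
    count (λ x → inV₁₁ (p x) ∨ inV₂₂ (p x)) + count (λ x → inV₁₁ (p x) ∧ inV₂₂ (p x))   ≡⟨ cong (count (λ x → inV₁₁ (p x) ∨ inV₂₂ (p x)) +_) (count-none _ (disjoint ∘ p)) ⟩
    count (λ x → inV₁₁ (p x) ∨ inV₂₂ (p x)) + 0                                    ≤⟨ +-monoˡ-≤ 0 (count≤m _) ⟩
    n + 0                                                                          ≡⟨ +-identityʳ n ⟩
    n                                                                              ∎
    where
    open ≤-Reasoning
    disjoint : ∀ a → (inV₁₁ a ∧ inV₂₂ a) ≡ false
    disjoint c₁₁ = refl
    disjoint c₁₂ = refl
    disjoint c₂₁ = refl
    disjoint c₂₂ = refl

  small-or-complement-small : ∀ {n a b} → a + b ≤ n → ¬ 2 * b ≤ n → 2 * a ≤ n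
  small-or-complement-small {n} {a} {b} a+b≤n 2b≰n = ≮⇒≥ λ n<2a → <-irrefl refl (begin-strict
    n + n             <⟨ +-mono-< n<2a (≰⇒> 2b≰n) ⟩
    2 * a + 2 * b     ≡⟨ *-distribˡ-+ 2 a b ⟨
    2 * (a + b)       ≤⟨ *-monoʳ-≤ 2 a+b≤n ⟩
    2 * n             ≡⟨ cong (n +_) (+-identityʳ n) ⟩
    n + n             ∎)
    where open ≤-Reasoning

import Data.Nat as ℕ
open import Data.Nat using (ℕ)
open import Data.Fin using (Fin; zero; suc)
open import Data.Bool using (Bool; _∨_; _∧_)
open import Data.Product using (_×_; _,_; proj₁; proj₂)
open import Data.Rational using (ℚ; _≤_; _+_; _*_)
open import Relation.Nullary using (Dec; yes; no)

lemma4p3 : (n : ℕ) (G : Digraph n) → IsRegularTripartiteTournament G →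
    (ε₁ ε₂ : ℚ) (p : Vtx n → Fin 2 × Fin 2) →
    ⟦ eG G (λ u → proj₁ (p u) == zero) (λ v → proj₂ (p v) == suc zero)
      Data.Nat.+ eG G (λ u → proj₁ (p u) == suc zero) (λ v → proj₂ (p v) == zero) ⟧
      ≤ ε₁ * ⟦ n ⟧ * ⟦ n ⟧ →
    ⟦ symDiff inA (λ v → (proj₁ (p v) == zero ∧ proj₂ (p v) == zero) ∨ (proj₁ (p v) == suc zero ∧ proj₂ (p v) == suc zero)) ⟧ ≤ ε₂ * ⟦ n ⟧ →
    ⟦ symDiff inB (λ v → proj₁ (p v) == zero ∧ proj₂ (p v) == suc zero) ⟧ ≤ ε₂ * ⟦ n ⟧ →
    ⟦ symDiff inC (λ v → proj₁ (p v) == suc zero ∧ proj₂ (p v) == zero) ⟧ ≤ ε₂ * ⟦ n ⟧ →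
    CloseToSomeGβ (⟦ 10 ⟧ * ε₁ + ⟦ 90 ⟧ * ε₂) G
lemma4p3 n G regular ε₁ ε₂ p crossing≤ misplacedA≤ misplacedB≤ misplacedC≤ = choose (2 ℕ.* k₂₂ ℕ.≤? n)
  where
  k₁₁ k₂₂ : ℕ
  k₁₁ = count (λ x → inV₁₁ (p (𝐴 , x)))
  k₂₂ = count (λ x → inV₂₂ (p (𝐴 , x)))
  choose : Dec (2 ℕ.* k₂₂ ℕ.≤ n) → CloseToSomeGβ (⟦ 10 ⟧ * ε₁ + ⟦ 90 ⟧ * ε₂) G
  choose (yes k₂₂-small) =
    let H , family , bound = Partition.approximation G regular p
    in k₂₂ , k₂₂-small , H , family , close-from-errors G regular p {H} ε₁ ε₂ bound crossing≤ misplacedA≤ misplacedB≤ misplacedC≤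
  choose (no k₂₂-large) =
    let H , family , bound = SwappedPartition.approximation G regular p
    in k₁₁ , small-or-complement-small {a = k₁₁} {b = k₂₂} (count-V₁₁+count-V₂₂≤n (λ x → p (𝐴 , x))) k₂₂-large , H , family ,
       close-from-errors G regular p {H} ε₁ ε₂ bound crossing≤ misplacedA≤ misplacedB≤ misplacedC≤
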